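{- Let $\varphi$ be a formula of $\mathrm{SCL}$. Then $\varphi$ is valid (i.e., $\mathfrak{A},s\models\varphi$ for all suitable $\mathfrak{A}$, $s$) if and only if the first-order formula $\Phi^n_\varphi$ is valid for some $n\in\mathbb{N}$.
   Context: Syntax. Fix purely relational vocabularies. $\mathrm{FO}$ has equality and $\bot$ as primitives and $\neg,\wedge,\vee,\exists,\forall$ ($\top$ abbreviates $\neg\bot$). Fix label symbols $L_0,L_1,\dots$ and for each $L$ a claim symbol $C_L$. Formulas: $\mathrm{FO}$ formation rules plus: each $C_L$ is atomic (no free variables); if $\varphi$ is a formula, $L\varphi$ is a formula (same free variables). FO-atoms are atomic formulas of $\mathrm{FO}$. The reference formula of an occurrence of $C_L$ is the subformula occurrence $L\psi$ above it in the syntax tree with no occurrence of $L$ strictly between (if none, that occurrence is free). Semantics ($\mathrm{SCL}$). $\mathcal{G}_\infty(\mathfrak{A},s,\varphi)$ has positions $(\psi,r,\#)$, $\#\in\{+,-\}$, starting at $(\varphi,s,+)$. FO-atom $\alpha$: if $\#=+$ Eloise wins iff $\mathfrak{A},r\models\alpha$, else Abelard; if $\#=-$ Abelard wins iff $\mathfrak{A},r\models\alpha$, else Eloise. $\neg$ flips the sign. $\wedge$: Abelard chooses if $+$, Eloise if $-$. $\vee$: Eloise if $+$, Abelard if $-$. $\forall x$: Abelard picks $a\in A$ if $+$, Eloise if $-$, assignment becomes $r[a/x]$. $\exists x$: Eloise if $+$, Abelard if $-$. $L\psi$: move to $\psi$. $C_L$: move to its reference formula (no winner if none). Infinite plays have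 no winner. $\mathfrak{A},s\models\varphi$ iff Eloise has a winning strategy. Approximants. A formula is regular if no label symbol occurs in it more than once and no label symbol $L$ occurs in it if $C_L$ occurs free in it. Let $\varphi'$ be a regular formula obtained from $\varphi$ by safely renaming label symbols together with the claim atoms referring to them ($\varphi'=\varphi$ if regular). Unfoldings: $\Psi^0_\varphi=\varphi'$; $\Psi^{k+1}_\varphi$ replaces every non-free claim atom occurrence of $\Psi^k_\varphi$ by its reference formula in $\Psi^k_\varphi$. The approximant $\Phi^n_\varphi$ is the $\mathrm{FO}$-formula obtained from $\Psi^n_\varphi$ by deleting all label symbols and replacing each claim atom occurrence by $\bot$ if it lies in the scope of an even number of negations and by $\top$ otherwise. -}

module Defs where

open import Level using (0ℓ)
open import Data.Nat using (ℕ; zero; suc; _+_; _≡ᵇ_; _⊔_; _≟_)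
open import Data.Bool using (Bool; true; false; not; if_then_else_; _∧_; _∨_)
open import Data.Maybe using (Maybe; just; nothing)
open import Data.Product using (Σ; _×_; _,_; proj₁; ∃)
open import Data.Sum using (_⊎_)
open import Data.Empty using (⊥)
open import Data.List using (List; []; _∷_; _++_)
open import Data.Bool.ListAction using (any; all)
open import Data.Vec using (Vec; map)
open import Relation.Binary.PropositionalEquality using (_≡_; refl)
open import Relation.Nullary using (¬_; yes; no)

record Vocabulary : Set₁ where
  field
    Symbol : Set
    arity  : Symbol → ℕ
open Vocabulary public

-- Variables are natural numbers x₀, x₁, …; label symbols are L₀, L₁, …
-- (represented by their index ℕ); C_L is represented by  claim L.
Var : Set
Var = ℕ

Label : Set
Label = ℕ

module _ (V : Vocabulary) where

  data Formula : Set where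
    rel    : (R : Symbol V) → Vec Var (arity V R) → Formula
    eq     : Var → Var → Formula
    bot    : Formula
    neg    : Formula → Formula
    and    : Formula → Formula → Formula
    or     : Formula → Formula → Formula
    ex     : Var → Formula → Formula
    all'   : Var → Formula → Formula
    lab    : Label → Formula → Formula
    claim  : Label → Formula

  data FOFormula : Set where
    rel    : (R : Symbol V) → Vec Var (arity V R) → FOFormula
    eq     : Var → Var → FOFormula
    bot    : FOFormula
    neg    : FOFormula → FOFormula
    and    : FOFormula → FOFormula → FOFormula
    or     : FOFormula → FOFormula → FOFormula
    ex     : Var → FOFormula → FOFormula
    all'   : Var → FOFormula → FOFormula

  record Structure : Set₁ where
    field
      Carrier : Set
      relI    : (R : Symbol V) → Vec Carrier (arity V R) → Set
  open Structure public

  Assignment : Structure → Set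
  Assignment 𝔄 = Var → Carrier 𝔄

  _[_/_] : {A : Set} → (Var → A) → A → Var → (Var → A)
  (s [ a / x ]) y = if y ≡ᵇ x then a else s y

  _,_⊨FO_ : (𝔄 : Structure) → Assignment 𝔄 → FOFormula → Set
  𝔄 , s ⊨FO rel R xs  = relI 𝔄 R (map s xs)
  𝔄 , s ⊨FO eq x y    = s x ≡ s y
  𝔄 , s ⊨FO bot       = ⊥
  𝔄 , s ⊨FO neg φ     = ¬ (𝔄 , s ⊨FO φ)
  𝔄 , s ⊨FO and φ ψ   = (𝔄 , s ⊨FO φ) × (𝔄 , s ⊨FO ψ)
  𝔄 , s ⊨FO or φ ψ    = (𝔄 , s ⊨FO φ) ⊎ (𝔄 , s ⊨FO ψ)
  𝔄 , s ⊨FO ex x φ    = Σ (Carrier 𝔄) λ a → 𝔄 , (s [ a / x ]) ⊨FO φ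
  𝔄 , s ⊨FO all' x φ  = (a : Carrier 𝔄) → 𝔄 , (s [ a / x ]) ⊨FO φ

  FOValid : FOFormula → Set₁
  FOValid φ = (𝔄 : Structure) (s : Assignment 𝔄) → 𝔄 , s ⊨FO φ

  -- Subformula occurrences of a formula φ (paths from the root)

  data Occ (φ : Formula) : Formula → Set where
    root  : Occ φ φ
    negO  : ∀ {ψ}   → Occ φ (neg ψ)    → Occ φ ψ
    andL  : ∀ {ψ χ} → Occ φ (and ψ χ)  → Occ φ ψ
    andR  : ∀ {ψ χ} → Occ φ (and ψ χ)  → Occ φ χ
    orL   : ∀ {ψ χ} → Occ φ (or ψ χ)   → Occ φ ψ
    orR   : ∀ {ψ χ} → Occ φ (or ψ χ)   → Occ φ χ
    exO   : ∀ {x ψ} → Occ φ (ex x ψ)   → Occ φ ψ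
    allO  : ∀ {x ψ} → Occ φ (all' x ψ) → Occ φ ψ
    labO  : ∀ {L ψ} → Occ φ (lab L ψ)  → Occ φ ψ

  refAbove : ∀ {φ χ} (L : Label) → Occ φ χ → Maybe (Σ Formula λ ψ → Occ φ (lab L ψ))
  refAbove L root     = nothing
  refAbove L (negO o) = refAbove L o
  refAbove L (andL o) = refAbove L o
  refAbove L (andR o) = refAbove L o
  refAbove L (orL o)  = refAbove L o
  refAbove L (orR o)  = refAbove L o
  refAbove L (exO o)  = refAbove L o
  refAbove L (allO o) = refAbove L o
  refAbove L (labO {L'} {ψ} o) with L' ≟ L
  ... | yes refl = just (ψ , o)
  ... | no _     = refAbove L o

  data Sign : Set where
    + - : Sign

  flip : Sign → Sign
  flip + = -
  flip - = +

  -- Since infinite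
  -- plays have no winner, a winning strategy is one all of whose plays are
  -- finite and won by Eloise; this is the inductive (well-founded) notion.
  data EWins (𝔄 : Structure) (φ : Formula)
       : (χ : Formula) → Occ φ χ → Assignment 𝔄 → Sign → Set where
    relP  : ∀ {R xs o r} → relI 𝔄 R (map r xs) → EWins 𝔄 φ (rel R xs) o r +
    relN  : ∀ {R xs o r} → ¬ relI 𝔄 R (map r xs) → EWins 𝔄 φ (rel R xs) o r -
    eqP   : ∀ {x y o r} → r x ≡ r y → EWins 𝔄 φ (eq x y) o r +
    eqN   : ∀ {x y o r} → ¬ (r x ≡ r y) → EWins 𝔄 φ (eq x y) o r -
    botN  : ∀ {o r} → ¬ ⊥ → EWins 𝔄 φ bot o r -
    negW  : ∀ {ψ o r s} → EWins 𝔄 φ ψ (negO o) r (flip s) → EWins 𝔄 φ (neg ψ) o r s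
    andP  : ∀ {ψ χ o r} → EWins 𝔄 φ ψ (andL o) r + → EWins 𝔄 φ χ (andR o) r +
          → EWins 𝔄 φ (and ψ χ) o r +
    andNL : ∀ {ψ χ o r} → EWins 𝔄 φ ψ (andL o) r - → EWins 𝔄 φ (and ψ χ) o r -
    andNR : ∀ {ψ χ o r} → EWins 𝔄 φ χ (andR o) r - → EWins 𝔄 φ (and ψ χ) o r -
    orPL  : ∀ {ψ χ o r} → EWins 𝔄 φ ψ (orL o) r + → EWins 𝔄 φ (or ψ χ) o r +
    orPR  : ∀ {ψ χ o r} → EWins 𝔄 φ χ (orR o) r + → EWins 𝔄 φ (or ψ χ) o r +
    orN   : ∀ {ψ χ o r} → EWins 𝔄 φ ψ (orL o) r - → EWins 𝔄 φ χ (orR o) r -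
          → EWins 𝔄 φ (or ψ χ) o r -
    allP  : ∀ {x ψ o r} → ((a : Carrier 𝔄) → EWins 𝔄 φ ψ (allO o) (r [ a / x ]) +)
          → EWins 𝔄 φ (all' x ψ) o r +
    allN  : ∀ {x ψ o r} → Σ (Carrier 𝔄) (λ a → EWins 𝔄 φ ψ (allO o) (r [ a / x ]) -)
          → EWins 𝔄 φ (all' x ψ) o r -
    exP   : ∀ {x ψ o r} → Σ (Carrier 𝔄) (λ a → EWins 𝔄 φ ψ (exO o) (r [ a / x ]) +)
          → EWins 𝔄 φ (ex x ψ) o r +
    exN   : ∀ {x ψ o r} → ((a : Carrier 𝔄) → EWins 𝔄 φ ψ (exO o) (r [ a / x ]) -)
          → EWins 𝔄 φ (ex x ψ) o r -
    labW  : ∀ {L ψ o r s} → EWins 𝔄 φ ψ (labO o) r s → EWins 𝔄 φ (lab L ψ) o r s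
    claimW : ∀ {L o ψ o' r s} → refAbove L o ≡ just (ψ , o')
           → EWins 𝔄 φ (lab L ψ) o' r s → EWins 𝔄 φ (claim L) o r s

  _,_⊨_ : (𝔄 : Structure) → Assignment 𝔄 → Formula → Set
  𝔄 , s ⊨ φ = EWins 𝔄 φ φ root s +

  Valid : Formula → Set₁
  Valid φ = (𝔄 : Structure) (s : Assignment 𝔄) → 𝔄 , s ⊨ φ

  labelsOf : Formula → List Label
  labelsOf (neg φ)    = labelsOf φ
  labelsOf (and φ ψ)  = labelsOf φ ++ labelsOf ψ
  labelsOf (or φ ψ)   = labelsOf φ ++ labelsOf ψ
  labelsOf (ex x φ)   = labelsOf φ
  labelsOf (all' x φ) = labelsOf φ
  labelsOf (lab L φ)  = L ∷ labelsOf φ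
  labelsOf _          = []

  elem : ℕ → List ℕ → Bool
  elem n = any (λ m → n ≡ᵇ m)

  freeClaims : List Label → Formula → List Label
  freeClaims b (neg φ)    = freeClaims b φ
  freeClaims b (and φ ψ)  = freeClaims b φ ++ freeClaims b ψ
  freeClaims b (or φ ψ)   = freeClaims b φ ++ freeClaims b ψ
  freeClaims b (ex x φ)   = freeClaims b φ
  freeClaims b (all' x φ) = freeClaims b φ
  freeClaims b (lab L φ)  = freeClaims (L ∷ b) φ
  freeClaims b (claim L)  = if elem L b then [] else L ∷ []
  freeClaims b _          = []

  noDup : List ℕ → Bool
  noDup []       = true
  noDup (n ∷ ns) = not (elem n ns) ∧ noDup ns

  isRegular : Formula → Bool
  isRegular φ = noDup (labelsOf φ)
              ∧ all (λ L → not (elem L (freeClaims [] φ))) (labelsOf φ)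

  maxIdx : Formula → ℕ
  maxIdx (neg φ)    = maxIdx φ
  maxIdx (and φ ψ)  = maxIdx φ ⊔ maxIdx ψ
  maxIdx (or φ ψ)   = maxIdx φ ⊔ maxIdx ψ
  maxIdx (ex x φ)   = maxIdx φ
  maxIdx (all' x φ) = maxIdx φ
  maxIdx (lab L φ)  = L ⊔ maxIdx φ
  maxIdx (claim L)  = L
  maxIdx _          = 0

  -- ρ maps labels in scope to their new names; c is the next fresh label.
  rename : (Label → Maybe Label) → ℕ → Formula → Formula × ℕ
  rename ρ c (neg φ) with rename ρ c φ
  ... | φ' , c' = neg φ' , c'
  rename ρ c (and φ ψ) with rename ρ c φ
  ... | φ' , c' with rename ρ c' ψ
  ... | ψ' , c'' = and φ' ψ' , c''
  rename ρ c (or φ ψ) with rename ρ c φ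
  ... | φ' , c' with rename ρ c' ψ
  ... | ψ' , c'' = or φ' ψ' , c''
  rename ρ c (ex x φ) with rename ρ c φ
  ... | φ' , c' = ex x φ' , c'
  rename ρ c (all' x φ) with rename ρ c φ
  ... | φ' , c' = all' x φ' , c'
  rename ρ c (lab L φ) with rename (λ K → if K ≡ᵇ L then just c else ρ K) (suc c) φ
  ... | φ' , c' = lab c φ' , c'
  rename ρ c (claim L) with ρ L
  ... | just L' = claim L' , c
  ... | nothing = claim L , c
  rename ρ c φ = φ , c

  regularize : Formula → Formula
  regularize φ = if isRegular φ then φ
                 else proj₁ (rename (λ _ → nothing) (suc (maxIdx φ)) φ)

  unfold : (Label → Maybe Formula) → Formula → Formula
  unfold e (neg φ)    = neg (unfold e φ)
  unfold e (and φ ψ)  = and (unfold e φ) (unfold e ψ)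
  unfold e (or φ ψ)   = or (unfold e φ) (unfold e ψ)
  unfold e (ex x φ)   = ex x (unfold e φ)
  unfold e (all' x φ) = all' x (unfold e φ)
  unfold e (lab L φ)  = lab L (unfold (λ K → if K ≡ᵇ L then just (lab L φ) else e K) φ)
  unfold e (claim L) with e L
  ... | just χ  = χ
  ... | nothing = claim L
  unfold e φ = φ

  Ψ : ℕ → Formula → Formula
  Ψ zero    φ = regularize φ
  Ψ (suc k) φ = unfold (λ _ → nothing) (Ψ k φ)

  -- even = true iff the current position is in the scope of an even
  -- number of negations.  ⊤ abbreviates ¬⊥.
  toFO : Bool → Formula → FOFormula
  toFO ev (rel R xs)  = rel R xs
  toFO ev (eq x y)    = eq x y
  toFO ev bot         = bot
  toFO ev (neg φ)     = neg (toFO (not ev) φ)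
  toFO ev (and φ ψ)   = and (toFO ev φ) (toFO ev ψ)
  toFO ev (or φ ψ)    = or (toFO ev φ) (toFO ev ψ)
  toFO ev (ex x φ)    = ex x (toFO ev φ)
  toFO ev (all' x φ)  = all' x (toFO ev φ)
  toFO ev (lab L φ)   = toFO ev φ
  toFO ev (claim L)   = if ev then bot else neg bot

  Φ : ℕ → Formula → FOFormula
  Φ n φ = toFO true (Ψ n φ)

-- Eloise's winning strategies are captured by a closure game in which a claim move looks
-- up its reference formula on the stack of labelled formulas passed so far, and a budget
-- bounds the number of claim moves along every play.  With budget 0 this is the evaluation
-- game of the approximant Φⁿ (a claim loses for whoever has to defend it), and unfolding
-- every claim once trades one unit of budget for one step Ψᵏ ↦ Ψᵏ⁺¹.  Unfolding is
-- capture-free as long as some ranking of the labels decreases from each label to the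
-- claims free under it; the preorder position of labels is such a ranking for a regular
-- formula, and the fresh names chosen by the renaming increase with depth.  Hence a valid
-- Φⁿ makes φ valid.  Conversely, if φ is valid then one budget d works in every
-- structure, and Φᵈ is valid: otherwise a fair proof search for Eloise has an infinite
-- open branch, and the atoms on it define a term model, quotiented by the negative
-- equations on the branch, in which Eloise has no winning strategy at all.

module Submission where

open import Defs
open import Axiom.DoubleNegationElimination using (em⇒dne)
open import Axiom.ExcludedMiddle using (ExcludedMiddle)
open import Axiom.UniquenessOfIdentityProofs using (module Decidable⇒UIP)
open import Data.Bool using (Bool; true; false; not; if_then_else_; T)
open import Data.Bool.ListAction using (all)
open import Data.Bool.Properties using (T-∧; T-not-≡)
open import Data.Empty using (⊥; ⊥-elim)
open import Data.List using (List; []; _∷_; _++_; length)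
open import Data.List.Membership.Propositional using (_∈_; _∉_; lose)
open import Data.List.Membership.Propositional.Properties using (∈-++⁺ˡ; ∈-++⁺ʳ)
open import Data.List.Properties using (++-assoc; ++-identityʳ)
open import Data.List.Relation.Binary.Subset.Propositional using (_⊆_)
open import Data.List.Relation.Unary.All using (All; []; _∷_)
import Data.List.Relation.Unary.All as All
open import Data.List.Relation.Unary.All.Properties using (all⁺) renaming (++⁺ to All-++⁺)
open import Data.List.Relation.Unary.Any using (Any; here; there)
import Data.List.Relation.Unary.Any as Any
open import Data.List.Relation.Unary.Any.Properties using (any⁺; any⁻; ++⁻; singleton⁻)
open import Data.Maybe using (Maybe; just; nothing)
import Data.Maybe as Maybe
open import Data.Maybe.Properties using (just-injective)
open import Data.Nat using (ℕ; zero; suc; _≡ᵇ_; _≟_; _≤_; _<_; z≤n; s≤s; s≤s⁻¹; _⊔_)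
import Data.Nat as ℕ
open import Data.Nat.Properties using (≡ᵇ⇒≡; ≡⇒≡ᵇ; ≮⇒≥; ≤-antisym; m≤n⇒m<n∨m≡n; ≤-refl; ≤-trans; n≤1+n; m≤n⇒m≤1+n; <-irrefl; <-asym; <-trans; +-suc; +-identityʳ; <-≤-trans; ≤-<-trans; m≤m⊔n; m≤n⊔m)
open import Data.Product using (Σ; ∃; _×_; _,_; proj₁; proj₂)
open import Data.Product.Properties using (Σ-≡,≡→≡)
open import Data.Sum using (_⊎_; inj₁; inj₂)
import Data.Sum as Sum
open import Data.Sum.Properties using (≡-dec)
open import Data.Unit using (⊤; tt)
open import Data.Vec using (Vec; []; _∷_; map)
open import Data.Vec.Properties using (map-cong; map-∘; ∷-injectiveˡ; ∷-injectiveʳ)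
open import Data.Vec.Relation.Binary.Pointwise.Inductive using (Pointwise; []; _∷_; map⁺; Pointwise-≡⇒≡)
import Data.Vec.Relation.Binary.Pointwise.Inductive as Pointwise
open import Function.Base using (_∘_)
open import Function.Bundles using (_⇔_; mk⇔; Equivalence)
open import Level using (0ℓ)
open import Relation.Binary.Construct.Closure.Equivalence using (EqClosure; gfold)
import Relation.Binary.Construct.Closure.Equivalence as EqClosure
open import Relation.Binary.PropositionalEquality using (_≡_; _≢_; _≗_; refl; sym; trans; cong; subst)
open import Relation.Binary.PropositionalEquality.Properties using (isEquivalence)
open import Relation.Nullary using (¬_; yes; no; Reflects; ofʸ; ofⁿ; proof)

-- The closure game

≡ᵇ-reflects : ∀ m n → Reflects (m ≡ n) (m ≡ᵇ n)
≡ᵇ-reflects m n = proof (m ≟ n)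

data Budget : Set where
  ∞   : Budget
  fin : ℕ → Budget

data _↝_ : Budget → Budget → Set where
  ∞↝∞  : ∞ ↝ ∞
  suc↝ : ∀ {n} → fin (suc n) ↝ fin n

data _≼_ : Budget → Budget → Set where
  fin≼ : ∀ {m n} → m ≤ n → fin m ≼ fin n
  ≼∞   : ∀ {β} → β ≼ ∞

↝-mono : ∀ {β₁ β₁′ β₂} → β₁ ≼ β₂ → β₁ ↝ β₁′ → ∃ λ β₂′ → β₂ ↝ β₂′ × β₁′ ≼ β₂′
↝-mono (fin≼ (s≤s m≤n)) suc↝ = _ , suc↝ , fin≼ m≤n
↝-mono ≼∞ _ = ∞ , ∞↝∞ , ≼∞

sucᴮ : Budget → Budget
sucᴮ ∞       = ∞
sucᴮ (fin n) = fin (suc n)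

≼-sucᴮ : ∀ {β₁ β₂} → β₁ ≼ β₂ → β₁ ≼ sucᴮ β₂
≼-sucᴮ (fin≼ m≤n) = fin≼ (m≤n⇒m≤1+n m≤n)
≼-sucᴮ ≼∞         = ≼∞

↝-≼-sucᴮ : ∀ {β₁ β₁′ β₂} → β₁ ≼ sucᴮ β₂ → β₁ ↝ β₁′ → β₁′ ≼ β₂
↝-≼-sucᴮ {β₂ = ∞}     _                  _    = ≼∞
↝-≼-sucᴮ {β₂ = fin n} (fin≼ (s≤s m≤n)) suc↝ = fin≼ m≤n

module _ (V : Vocabulary) where

  _⟨_/_⟩ : {A : Set} → (Var → A) → A → Var → Var → A
  _⟨_/_⟩ = _[_/_] V

  ⟨/⟩-cong : ∀ {A : Set} {r r′ : Var → A} a x → r ≗ r′ → r ⟨ a / x ⟩ ≗ r′ ⟨ a / x ⟩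
  ⟨/⟩-cong a x r≗r′ y with y ≡ᵇ x
  ... | true  = refl
  ... | false = r≗r′ y

  ∘-⟨/⟩ : ∀ {A B : Set} (f : A → B) (a : Var → A) t x → f ∘ (a ⟨ t / x ⟩) ≗ (f ∘ a) ⟨ f t / x ⟩
  ∘-⟨/⟩ f a t x y with y ≡ᵇ x
  ... | true  = refl
  ... | false = refl

  Stack : Set
  Stack = List (Label × Formula V)

  lookup : Label → Stack → Maybe (Formula V × Stack)
  lookup L []              = nothing
  lookup L ((K , ψ) ∷ st) with K ≟ L
  ... | yes _ = just (ψ , st)
  ... | no _  = lookup L st

  lookup-head : ∀ c ψ st → lookup c ((c , ψ) ∷ st) ≡ just (ψ , st)
  lookup-head c ψ st with c ≟ c
  ... | yes _  = refl
  ... | no c≢c = ⊥-elim (c≢c refl)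

  lookup-tail : ∀ {c K} ψ st → c ≢ K → lookup K ((c , ψ) ∷ st) ≡ lookup K st
  lookup-tail {c} {K} ψ st c≢K with c ≟ K
  ... | yes c≡K = ⊥-elim (c≢K c≡K)
  ... | no _    = refl

  -- Eloise wins G∞ from (χ, r, s) when claims are resolved on the stack st of labelled
  -- formulas passed, making at most β claim moves along every play.
  data Wins (𝔄 : Structure V) : Budget → Stack → Formula V → Assignment V 𝔄 → Sign V → Set where
    relP  : ∀ {β st R xs r} → relI 𝔄 R (map r xs) → Wins 𝔄 β st (rel R xs) r +
    relN  : ∀ {β st R xs r} → ¬ relI 𝔄 R (map r xs) → Wins 𝔄 β st (rel R xs) r -
    eqP   : ∀ {β st x y r} → r x ≡ r y → Wins 𝔄 β st (eq x y) r +
    eqN   : ∀ {β st x y r} → r x ≢ r y → Wins 𝔄 β st (eq x y) r -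
    botN  : ∀ {β st r} → Wins 𝔄 β st bot r -
    negW  : ∀ {β st ψ r s} → Wins 𝔄 β st ψ r (flip V s) → Wins 𝔄 β st (neg ψ) r s
    andP  : ∀ {β st ψ χ r} → Wins 𝔄 β st ψ r + → Wins 𝔄 β st χ r + → Wins 𝔄 β st (and ψ χ) r +
    andNL : ∀ {β st ψ χ r} → Wins 𝔄 β st ψ r - → Wins 𝔄 β st (and ψ χ) r -
    andNR : ∀ {β st ψ χ r} → Wins 𝔄 β st χ r - → Wins 𝔄 β st (and ψ χ) r -
    orPL  : ∀ {β st ψ χ r} → Wins 𝔄 β st ψ r + → Wins 𝔄 β st (or ψ χ) r +
    orPR  : ∀ {β st ψ χ r} → Wins 𝔄 β st χ r + → Wins 𝔄 β st (or ψ χ) r +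
    orN   : ∀ {β st ψ χ r} → Wins 𝔄 β st ψ r - → Wins 𝔄 β st χ r - → Wins 𝔄 β st (or ψ χ) r -
    allP  : ∀ {β st x ψ r} → ((a : Carrier 𝔄) → Wins 𝔄 β st ψ (r ⟨ a / x ⟩) +) → Wins 𝔄 β st (all' x ψ) r +
    allN  : ∀ {β st x ψ r} → (∃ λ a → Wins 𝔄 β st ψ (r ⟨ a / x ⟩) -) → Wins 𝔄 β st (all' x ψ) r -
    exP   : ∀ {β st x ψ r} → (∃ λ a → Wins 𝔄 β st ψ (r ⟨ a / x ⟩) +) → Wins 𝔄 β st (ex x ψ) r +
    exN   : ∀ {β st x ψ r} → ((a : Carrier 𝔄) → Wins 𝔄 β st ψ (r ⟨ a / x ⟩) -) → Wins 𝔄 β st (ex x ψ) r -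
    labW  : ∀ {β st L ψ r s} → Wins 𝔄 β ((L , ψ) ∷ st) ψ r s → Wins 𝔄 β st (lab L ψ) r s
    claimW : ∀ {β β′ st L ψ rest r s} → β ↝ β′ → lookup L st ≡ just (ψ , rest)
           → Wins 𝔄 β′ rest (lab L ψ) r s → Wins 𝔄 β st (claim L) r s

  module _ {𝔄 : Structure V} where

    Wins-mono : ∀ {β β′ st χ r s} → β ≼ β′ → Wins 𝔄 β st χ r s → Wins 𝔄 β′ st χ r s
    Wins-mono β≼ (relP h)       = relP h
    Wins-mono β≼ (relN h)       = relN h
    Wins-mono β≼ (eqP h)        = eqP h
    Wins-mono β≼ (eqN h)        = eqN h
    Wins-mono β≼ botN           = botN
    Wins-mono β≼ (negW w)       = negW (Wins-mono β≼ w)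
    Wins-mono β≼ (andP w w′)    = andP (Wins-mono β≼ w) (Wins-mono β≼ w′)
    Wins-mono β≼ (andNL w)      = andNL (Wins-mono β≼ w)
    Wins-mono β≼ (andNR w)      = andNR (Wins-mono β≼ w)
    Wins-mono β≼ (orPL w)       = orPL (Wins-mono β≼ w)
    Wins-mono β≼ (orPR w)       = orPR (Wins-mono β≼ w)
    Wins-mono β≼ (orN w w′)     = orN (Wins-mono β≼ w) (Wins-mono β≼ w′)
    Wins-mono β≼ (allP f)       = allP λ a → Wins-mono β≼ (f a)
    Wins-mono β≼ (allN (a , w)) = allN (a , Wins-mono β≼ w)
    Wins-mono β≼ (exP (a , w))  = exP (a , Wins-mono β≼ w)
    Wins-mono β≼ (exN f)        = exN λ a → Wins-mono β≼ (f a)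
    Wins-mono β≼ (labW w)       = labW (Wins-mono β≼ w)
    Wins-mono β≼ (claimW ↝β′ lk w) with ↝-mono β≼ ↝β′
    ... | _ , ↝β″ , β′≼ = claimW ↝β″ lk (Wins-mono β′≼ w)

    Wins-resp-≗ : ∀ {β st χ r r′ s} → r ≗ r′ → Wins 𝔄 β st χ r s → Wins 𝔄 β st χ r′ s
    Wins-resp-≗ r≗ (relP {R = R} {xs} h) = relP (subst (relI 𝔄 R) (map-cong r≗ xs) h)
    Wins-resp-≗ r≗ (relN {R = R} {xs} h) = relN (h ∘ subst (relI 𝔄 R) (sym (map-cong r≗ xs)))
    Wins-resp-≗ r≗ (eqP {x = x} {y} h)   = eqP (trans (sym (r≗ x)) (trans h (r≗ y)))
    Wins-resp-≗ r≗ (eqN {x = x} {y} h)   = eqN λ e → h (trans (r≗ x) (trans e (sym (r≗ y))))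
    Wins-resp-≗ r≗ botN                  = botN
    Wins-resp-≗ r≗ (negW w)              = negW (Wins-resp-≗ r≗ w)
    Wins-resp-≗ r≗ (andP w w′)           = andP (Wins-resp-≗ r≗ w) (Wins-resp-≗ r≗ w′)
    Wins-resp-≗ r≗ (andNL w)             = andNL (Wins-resp-≗ r≗ w)
    Wins-resp-≗ r≗ (andNR w)             = andNR (Wins-resp-≗ r≗ w)
    Wins-resp-≗ r≗ (orPL w)              = orPL (Wins-resp-≗ r≗ w)
    Wins-resp-≗ r≗ (orPR w)              = orPR (Wins-resp-≗ r≗ w)
    Wins-resp-≗ r≗ (orN w w′)            = orN (Wins-resp-≗ r≗ w) (Wins-resp-≗ r≗ w′)
    Wins-resp-≗ r≗ (allP {x = x} f)      = allP λ a → Wins-resp-≗ (⟨/⟩-cong a x r≗) (f a)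
    Wins-resp-≗ r≗ (allN {x = x} (a , w)) = allN (a , Wins-resp-≗ (⟨/⟩-cong a x r≗) w)
    Wins-resp-≗ r≗ (exP {x = x} (a , w)) = exP (a , Wins-resp-≗ (⟨/⟩-cong a x r≗) w)
    Wins-resp-≗ r≗ (exN {x = x} f)       = exN λ a → Wins-resp-≗ (⟨/⟩-cong a x r≗) (f a)
    Wins-resp-≗ r≗ (labW w)              = labW (Wins-resp-≗ r≗ w)
    Wins-resp-≗ r≗ (claimW ↝β lk w)      = claimW ↝β lk (Wins-resp-≗ r≗ w)

  stackOf : ∀ {φ χ} → Occ V φ χ → Stack
  stackOf root              = []
  stackOf (negO o)          = stackOf o
  stackOf (andL o)          = stackOf o
  stackOf (andR o)          = stackOf o
  stackOf (orL o)           = stackOf o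
  stackOf (orR o)           = stackOf o
  stackOf (exO o)           = stackOf o
  stackOf (allO o)          = stackOf o
  stackOf (labO {L} {ψ} o)  = (L , ψ) ∷ stackOf o

  refAbove≡lookup : ∀ {φ χ} L (o : Occ V φ χ)
                  → Maybe.map (λ (ψ , o′) → ψ , stackOf o′) (refAbove V L o) ≡ lookup L (stackOf o)
  refAbove≡lookup L root     = refl
  refAbove≡lookup L (negO o) = refAbove≡lookup L o
  refAbove≡lookup L (andL o) = refAbove≡lookup L o
  refAbove≡lookup L (andR o) = refAbove≡lookup L o
  refAbove≡lookup L (orL o)  = refAbove≡lookup L o
  refAbove≡lookup L (orR o)  = refAbove≡lookup L o
  refAbove≡lookup L (exO o)  = refAbove≡lookup L o
  refAbove≡lookup L (allO o) = refAbove≡lookup L o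
  refAbove≡lookup L (labO {K} o) with K ≟ L
  ... | yes refl = refl
  ... | no _     = refAbove≡lookup L o

  module _ {𝔄 : Structure V} {φ : Formula V} where

    EWins⇒Wins : ∀ {χ o r s} → EWins V 𝔄 φ χ o r s → Wins 𝔄 ∞ (stackOf o) χ r s
    EWins⇒Wins (relP h)       = relP h
    EWins⇒Wins (relN h)       = relN h
    EWins⇒Wins (eqP h)        = eqP h
    EWins⇒Wins (eqN h)        = eqN h
    EWins⇒Wins (botN _)       = botN
    EWins⇒Wins (negW w)       = negW (EWins⇒Wins w)
    EWins⇒Wins (andP w w′)    = andP (EWins⇒Wins w) (EWins⇒Wins w′)
    EWins⇒Wins (andNL w)      = andNL (EWins⇒Wins w)
    EWins⇒Wins (andNR w)      = andNR (EWins⇒Wins w)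
    EWins⇒Wins (orPL w)       = orPL (EWins⇒Wins w)
    EWins⇒Wins (orPR w)       = orPR (EWins⇒Wins w)
    EWins⇒Wins (orN w w′)     = orN (EWins⇒Wins w) (EWins⇒Wins w′)
    EWins⇒Wins (allP f)       = allP λ a → EWins⇒Wins (f a)
    EWins⇒Wins (allN (a , w)) = allN (a , EWins⇒Wins w)
    EWins⇒Wins (exP (a , w))  = exP (a , EWins⇒Wins w)
    EWins⇒Wins (exN f)        = exN λ a → EWins⇒Wins (f a)
    EWins⇒Wins (labW w)       = labW (EWins⇒Wins w)
    EWins⇒Wins {o = o} (claimW {L = L} ref w) =
      claimW ∞↝∞ (trans (sym (refAbove≡lookup L o)) (cong (Maybe.map _) ref)) (EWins⇒Wins w)

    Wins⇒EWins : ∀ {β st χ r s} → Wins 𝔄 β st χ r s → (o : Occ V φ χ) → stackOf o ≡ st → EWins V 𝔄 φ χ o r s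
    Wins⇒EWins (relP h)       o _ = relP h
    Wins⇒EWins (relN h)       o _ = relN h
    Wins⇒EWins (eqP h)        o _ = eqP h
    Wins⇒EWins (eqN h)        o _ = eqN h
    Wins⇒EWins botN           o _ = botN λ ()
    Wins⇒EWins (negW w)       o e = negW (Wins⇒EWins w (negO o) e)
    Wins⇒EWins (andP w w′)    o e = andP (Wins⇒EWins w (andL o) e) (Wins⇒EWins w′ (andR o) e)
    Wins⇒EWins (andNL w)      o e = andNL (Wins⇒EWins w (andL o) e)
    Wins⇒EWins (andNR w)      o e = andNR (Wins⇒EWins w (andR o) e)
    Wins⇒EWins (orPL w)       o e = orPL (Wins⇒EWins w (orL o) e)
    Wins⇒EWins (orPR w)       o e = orPR (Wins⇒EWins w (orR o) e)
    Wins⇒EWins (orN w w′)     o e = orN (Wins⇒EWins w (orL o) e) (Wins⇒EWins w′ (orR o) e)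
    Wins⇒EWins (allP f)       o e = allP λ a → Wins⇒EWins (f a) (allO o) e
    Wins⇒EWins (allN (a , w)) o e = allN (a , Wins⇒EWins w (allO o) e)
    Wins⇒EWins (exP (a , w))  o e = exP (a , Wins⇒EWins w (exO o) e)
    Wins⇒EWins (exN f)        o e = exN λ a → Wins⇒EWins (f a) (exO o) e
    Wins⇒EWins (labW w)       o refl = labW (Wins⇒EWins w (labO o) refl)
    Wins⇒EWins (claimW {L = L} _ lk w) o refl
      with refAbove V L o in ref | trans (refAbove≡lookup L o) lk
    ... | just (ψ , o′) | e with just-injective e
    ...   | refl = claimW ref (Wins⇒EWins w o′ refl)

  -- Approximants as the game with budget 0

  module _ {𝔄 : Structure V} where

    FOWins : Sign V → Assignment V 𝔄 → Formula V → Set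
    FOWins + r χ = _,_⊨FO_ V 𝔄 r (toFO V true χ)
    FOWins - r χ = ¬ _,_⊨FO_ V 𝔄 r (toFO V false χ)

    Wins₀⇒FOWins : ∀ {st χ r s} → Wins 𝔄 (fin 0) st χ r s → FOWins s r χ
    Wins₀⇒FOWins (relP h)             = h
    Wins₀⇒FOWins (relN h)             = h
    Wins₀⇒FOWins (eqP h)              = h
    Wins₀⇒FOWins (eqN h)              = h
    Wins₀⇒FOWins botN                 = λ ()
    Wins₀⇒FOWins (negW {s = + } w)     = Wins₀⇒FOWins w
    Wins₀⇒FOWins (negW {s = - } w)     = λ ¬h → ¬h (Wins₀⇒FOWins w)
    Wins₀⇒FOWins (andP w w′)          = Wins₀⇒FOWins w , Wins₀⇒FOWins w′
    Wins₀⇒FOWins (andNL w) (h , _)    = Wins₀⇒FOWins w h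
    Wins₀⇒FOWins (andNR w) (_ , h)    = Wins₀⇒FOWins w h
    Wins₀⇒FOWins (orPL w)             = inj₁ (Wins₀⇒FOWins w)
    Wins₀⇒FOWins (orPR w)             = inj₂ (Wins₀⇒FOWins w)
    Wins₀⇒FOWins (orN w w′) (inj₁ h)  = Wins₀⇒FOWins w h
    Wins₀⇒FOWins (orN w w′) (inj₂ h)  = Wins₀⇒FOWins w′ h
    Wins₀⇒FOWins (allP f)             = λ a → Wins₀⇒FOWins (f a)
    Wins₀⇒FOWins (allN (a , w)) h     = Wins₀⇒FOWins w (h a)
    Wins₀⇒FOWins (exP (a , w))        = a , Wins₀⇒FOWins w
    Wins₀⇒FOWins (exN f) (a , h)      = Wins₀⇒FOWins (f a) h
    Wins₀⇒FOWins (labW {s = + } w)    = Wins₀⇒FOWins w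
    Wins₀⇒FOWins (labW {s = - } w)    = Wins₀⇒FOWins w
    Wins₀⇒FOWins (claimW () _ _)

    module _ (em : ExcludedMiddle 0ℓ) where

      private
        dne : {P : Set} → ¬ ¬ P → P
        dne = em⇒dne em

        ¬∀⇒∃¬ : {A : Set} {P : A → Set} → ¬ (∀ a → P a) → ∃ λ a → ¬ P a
        ¬∀⇒∃¬ ¬∀ = dne λ ¬∃ → ¬∀ λ a → dne λ ¬Pa → ¬∃ (a , ¬Pa)

      FOWins⇒Wins : ∀ {β st} χ s r → FOWins s r χ → Wins 𝔄 β st χ r s
      FOWins⇒Wins (rel R xs) + r h        = relP h
      FOWins⇒Wins (rel R xs) - r h        = relN h
      FOWins⇒Wins (eq x y)   + r h        = eqP h
      FOWins⇒Wins (eq x y)   - r h        = eqN h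
      FOWins⇒Wins bot        - r h        = botN
      FOWins⇒Wins (neg χ)    + r h        = negW (FOWins⇒Wins χ - r h)
      FOWins⇒Wins (neg χ)    - r h        = negW (FOWins⇒Wins χ + r (dne h))
      FOWins⇒Wins (and χ ψ)  + r (h , h′) = andP (FOWins⇒Wins χ + r h) (FOWins⇒Wins ψ + r h′)
      FOWins⇒Wins (and χ ψ)  - r h with em {_,_⊨FO_ V 𝔄 r (toFO V false χ)}
      ... | yes hχ = andNR (FOWins⇒Wins ψ - r λ hψ → h (hχ , hψ))
      ... | no ¬hχ = andNL (FOWins⇒Wins χ - r ¬hχ)
      FOWins⇒Wins (or χ ψ)   + r (inj₁ h) = orPL (FOWins⇒Wins χ + r h)
      FOWins⇒Wins (or χ ψ)   + r (inj₂ h) = orPR (FOWins⇒Wins ψ + r h)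
      FOWins⇒Wins (or χ ψ)   - r h        =
        orN (FOWins⇒Wins χ - r (h ∘ inj₁)) (FOWins⇒Wins ψ - r (h ∘ inj₂))
      FOWins⇒Wins (ex x χ)   + r (a , h)  = exP (a , FOWins⇒Wins χ + _ h)
      FOWins⇒Wins (ex x χ)   - r h        = exN λ a → FOWins⇒Wins χ - _ λ h′ → h (a , h′)
      FOWins⇒Wins (all' x χ) + r h        = allP λ a → FOWins⇒Wins χ + _ (h a)
      FOWins⇒Wins (all' x χ) - r h with ¬∀⇒∃¬ h
      ... | a , ¬h = allN (a , FOWins⇒Wins χ - _ ¬h)
      FOWins⇒Wins (lab L χ)  + r h        = labW (FOWins⇒Wins χ + r h)
      FOWins⇒Wins (lab L χ)  - r h        = labW (FOWins⇒Wins χ - r h)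
      FOWins⇒Wins (claim L)  - r h        = ⊥-elim (h λ ())

  data _◃_ : Formula V → Formula V → Set where
    neg◃  : ∀ {ψ}   → ψ ◃ neg ψ
    andˡ◃ : ∀ {ψ χ} → ψ ◃ and ψ χ
    andʳ◃ : ∀ {ψ χ} → χ ◃ and ψ χ
    orˡ◃  : ∀ {ψ χ} → ψ ◃ or ψ χ
    orʳ◃  : ∀ {ψ χ} → χ ◃ or ψ χ
    ex◃   : ∀ {x ψ} → ψ ◃ ex x ψ
    all◃  : ∀ {x ψ} → ψ ◃ all' x ψ

  data FreeIn (K : Label) : Formula V → Set where
    here  : FreeIn K (claim K)
    sub   : ∀ {ψ χ} → ψ ◃ χ → FreeIn K ψ → FreeIn K χ
    under : ∀ {L ψ} → K ≢ L → FreeIn K ψ → FreeIn K (lab L ψ)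

  -- Unfolding

  env : Stack → Label → Maybe (Formula V)
  env []             K = nothing
  env ((L , ψ) ∷ st) K = if K ≡ᵇ L then just (lab L ψ) else env st K

  env≡lookup : ∀ st K → env st K ≡ Maybe.map (λ (ψ , _) → lab K ψ) (lookup K st)
  env≡lookup []             K = refl
  env≡lookup ((L , ψ) ∷ st) K with K ≡ᵇ L | ≡ᵇ-reflects K L | L ≟ K
  ... | true  | ofʸ refl | yes _   = refl
  ... | true  | ofʸ refl | no L≢L  = ⊥-elim (L≢L refl)
  ... | false | ofⁿ K≢L  | yes L≡K = ⊥-elim (K≢L (sym L≡K))
  ... | false | ofⁿ _    | no _    = env≡lookup st K

  env-ref : ∀ st {K ψ rest} → lookup K st ≡ just (ψ , rest) → env st K ≡ just (lab K ψ)
  env-ref st lk = trans (env≡lookup st _) (cong (Maybe.map _) lk)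

  -- the stack met in Ψᵏ⁺¹ at the image of a position of Ψᵏ with stack st
  unfoldStack : Stack → Stack
  unfoldStack []             = []
  unfoldStack ((L , ψ) ∷ st) = (L , unfold V (env ((L , ψ) ∷ st)) ψ) ∷ unfoldStack st

  -- A position of Ψᵏ is related to one of Ψᵏ⁺¹ either as its unfolding, or, inside a
  -- reference formula copied by the unfolding, as the same formula whose free claims
  -- refer to related stack entries.
  data Mode : Set where
    expanding : Mode
    copying   : Mode

  mutual
    data Sim : Mode → Stack → Formula V → Stack → Formula V → Set where
      expanded : ∀ {st χ} → Sim expanding st χ (unfoldStack st) (unfold V (env st) χ)
      copied   : ∀ {st₁ st₂ χ} → (∀ K → FreeIn K χ → SimRef K (lookup K st₁) (lookup K st₂))
               → Sim copying st₁ χ st₂ χ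

    data SimRef (K : Label) : Maybe (Formula V × Stack) → Maybe (Formula V × Stack) → Set where
      none : SimRef K nothing nothing
      some : ∀ {m ψ₁ ψ₂ rest₁ rest₂} → Sim m rest₁ (lab K ψ₁) rest₂ (lab K ψ₂)
           → SimRef K (just (ψ₁ , rest₁)) (just (ψ₂ , rest₂))

  expanded-ref : ∀ K st → SimRef K (lookup K st) (lookup K (unfoldStack st))
  expanded-ref K []             = none
  expanded-ref K ((L , ψ) ∷ st) with L ≟ K
  ... | yes refl = some expanded
  ... | no _     = expanded-ref K st

  SimRef-nothing : ∀ {K l} → SimRef K nothing l → l ≡ nothing
  SimRef-nothing none = refl

  copied-◃ : ∀ {st₁ st₂ ψ χ} → ψ ◃ χ → Sim copying st₁ χ st₂ χ → Sim copying st₁ ψ st₂ ψ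
  copied-◃ ψ◃χ (copied refs) = copied λ K f → refs K (sub ψ◃χ f)

  copied-lab : ∀ {st₁ st₂ L ψ} → Sim copying st₁ (lab L ψ) st₂ (lab L ψ)
             → Sim copying ((L , ψ) ∷ st₁) ψ ((L , ψ) ∷ st₂) ψ
  copied-lab {st₁} {st₂} {L} {ψ} sim@(copied refs) = copied refs′
    where
    refs′ : ∀ K → FreeIn K ψ → SimRef K (lookup K ((L , ψ) ∷ st₁)) (lookup K ((L , ψ) ∷ st₂))
    refs′ K f with L ≟ K
    ... | yes refl = some sim
    ... | no L≢K   = refs K (under (L≢K ∘ sym) f)

  FreeVia : (Label → Maybe (Formula V)) → Formula V → Label → Set
  FreeVia e χ M = FreeIn M χ ⊎ ∃ λ K → ∃ λ ξ → FreeIn K χ × e K ≡ just ξ × FreeIn M ξ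

  FreeVia-◃ : ∀ {e ψ χ M} → ψ ◃ χ → FreeVia e ψ M → FreeVia e χ M
  FreeVia-◃ ψ◃χ (inj₁ f)                   = inj₁ (sub ψ◃χ f)
  FreeVia-◃ ψ◃χ (inj₂ (K , ξ , fK , eK , fM)) = inj₂ (K , ξ , sub ψ◃χ fK , eK , fM)

  FreeIn-unfold : ∀ e χ {M} → FreeIn M (unfold V e χ) → FreeVia e χ M
  FreeIn-unfold e (rel R xs) (sub () _)
  FreeIn-unfold e (eq x y)   (sub () _)
  FreeIn-unfold e bot        (sub () _)
  FreeIn-unfold e (neg ψ)    (sub neg◃ f)  = FreeVia-◃ neg◃ (FreeIn-unfold e ψ f)
  FreeIn-unfold e (and ψ χ)  (sub andˡ◃ f) = FreeVia-◃ andˡ◃ (FreeIn-unfold e ψ f)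
  FreeIn-unfold e (and ψ χ)  (sub andʳ◃ f) = FreeVia-◃ andʳ◃ (FreeIn-unfold e χ f)
  FreeIn-unfold e (or ψ χ)   (sub orˡ◃ f)  = FreeVia-◃ orˡ◃ (FreeIn-unfold e ψ f)
  FreeIn-unfold e (or ψ χ)   (sub orʳ◃ f)  = FreeVia-◃ orʳ◃ (FreeIn-unfold e χ f)
  FreeIn-unfold e (ex x ψ)   (sub ex◃ f)   = FreeVia-◃ ex◃ (FreeIn-unfold e ψ f)
  FreeIn-unfold e (all' x ψ) (sub all◃ f)  = FreeVia-◃ all◃ (FreeIn-unfold e ψ f)
  FreeIn-unfold e (lab L ψ)  (under M≢L f) with FreeIn-unfold _ ψ f
  ... | inj₁ f′ = inj₁ (under M≢L f′)
  ... | inj₂ (K , ξ , fK , eK , fM) with K ≡ᵇ L | ≡ᵇ-reflects K L | eK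
  ...   | true  | ofʸ refl | refl = inj₁ fM
  ...   | false | ofⁿ K≢L  | eK′  = inj₂ (K , ξ , under K≢L fK , eK′ , fM)
  FreeIn-unfold e (claim K) f with e K in eK
  ... | just ξ  = inj₂ (K , ξ , here , eK , f)
  ... | nothing = inj₁ f

  module _ (ι : Label → ℕ) where

    Ranked : Formula V → Set
    Ranked (neg ψ)    = Ranked ψ
    Ranked (and ψ χ)  = Ranked ψ × Ranked χ
    Ranked (or ψ χ)   = Ranked ψ × Ranked χ
    Ranked (ex x ψ)   = Ranked ψ
    Ranked (all' x ψ) = Ranked ψ
    Ranked (lab L ψ)  = (∀ M → FreeIn M (lab L ψ) → ι M < ι L) × Ranked ψ
    Ranked _          = ⊤

    ◃-Ranked : ∀ {ψ χ} → ψ ◃ χ → Ranked χ → Ranked ψ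
    ◃-Ranked neg◃  rχ       = rχ
    ◃-Ranked andˡ◃ (rψ , _) = rψ
    ◃-Ranked andʳ◃ (_ , rχ) = rχ
    ◃-Ranked orˡ◃  (rψ , _) = rψ
    ◃-Ranked orʳ◃  (_ , rχ) = rχ
    ◃-Ranked ex◃   rψ       = rψ
    ◃-Ranked all◃  rψ       = rψ

    Outranked : Label → Stack → Set
    Outranked K []             = ⊤
    Outranked K ((L , _) ∷ st) with L ≟ K
    ... | yes _ = ⊤
    ... | no _  = ι K < ι L × Outranked K st

    FreeOutranked : Stack → Formula V → Set
    FreeOutranked st χ = ∀ K → FreeIn K χ → Outranked K st

    RankedStack : Stack → Set
    RankedStack []             = ⊤
    RankedStack ((L , ψ) ∷ st) = Ranked (lab L ψ) × FreeOutranked st (lab L ψ) × RankedStack st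

    WellRanked : Stack → Formula V → Set
    WellRanked st χ = Ranked χ × FreeOutranked st χ × RankedStack st

    WellRanked-◃ : ∀ {st ψ χ} → ψ ◃ χ → WellRanked st χ → WellRanked st ψ
    WellRanked-◃ ψ◃χ (rχ , out , rst) = ◃-Ranked ψ◃χ rχ , (λ K f → out K (sub ψ◃χ f)) , rst

    WellRanked-lab : ∀ {st L ψ} → WellRanked st (lab L ψ) → WellRanked ((L , ψ) ∷ st) ψ
    WellRanked-lab {st} {L} {ψ} wr@((rank , rψ) , out , rst) = rψ , out′ , wr
      where
      out′ : FreeOutranked ((L , ψ) ∷ st) ψ
      out′ K f with L ≟ K
      ... | yes _  = tt
      ... | no L≢K = rank K (under (L≢K ∘ sym) f) , out K (under (L≢K ∘ sym) f)

    WellRanked-ref : ∀ {st K ψ rest} → RankedStack st → lookup K st ≡ just (ψ , rest) → WellRanked rest (lab K ψ)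
    WellRanked-ref {(L , _) ∷ st} {K} (r , out , rst) lk with L ≟ K
    WellRanked-ref (r , out , rst) refl | yes refl = r , out , rst
    ... | no _ = WellRanked-ref {st} rst lk

    -- Ranks decrease from a label to the claims free under it and increase up the stack
    -- above the entry of K, so no claim free in the reference formula of K is captured.
    lookup-uncaptured : ∀ {st K ψ rest M} → lookup K st ≡ just (ψ , rest) → Outranked K st
                      → ι M < ι K → lookup M st ≡ lookup M rest
    lookup-uncaptured {(L , _) ∷ st} {K} {M = M} lk out M<K with L ≟ K
    lookup-uncaptured {(L , _) ∷ st} {M = M} refl out M<K | yes refl with L ≟ M
    ... | yes refl = ⊥-elim (<-irrefl refl M<K)
    ... | no _     = refl
    lookup-uncaptured {(L , _) ∷ st} {M = M} lk (K<L , out) M<K | no _ with L ≟ M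
    ... | yes refl = ⊥-elim (<-asym M<K K<L)
    ... | no _     = lookup-uncaptured {st} lk out M<K

    copied-ref : ∀ {st K ψ rest} → lookup K st ≡ just (ψ , rest) → Outranked K st → Ranked (lab K ψ)
               → Sim copying rest (lab K ψ) (unfoldStack st) (lab K ψ)
    copied-ref {st} lk out (rank , _) = copied λ M f →
      subst (λ l → SimRef M l (lookup M (unfoldStack st)))
            (lookup-uncaptured {st} lk out (rank M f)) (expanded-ref M st)

    claim-copy : ∀ {st K ψ rest} → WellRanked st (claim K) → lookup K st ≡ just (ψ , rest)
               → WellRanked ((K , ψ) ∷ rest) ψ × Sim copying ((K , ψ) ∷ rest) ψ ((K , ψ) ∷ unfoldStack st) ψ
    claim-copy {st} (_ , out , rst) lk = WellRanked-lab ref , copied-lab (copied-ref lk (out _ here) (proj₁ ref))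
      where ref = WellRanked-ref {st} rst lk

    EnvRanked : (Label → Maybe (Formula V)) → Set
    EnvRanked e = ∀ K ξ → e K ≡ just ξ → Ranked ξ × (∀ M → FreeIn M ξ → ι M < ι K)

    Ranked-unfold : ∀ e χ → EnvRanked e → Ranked χ → Ranked (unfold V e χ)
    Ranked-unfold e (rel R xs) _  _          = tt
    Ranked-unfold e (eq x y)   _  _          = tt
    Ranked-unfold e bot        _  _          = tt
    Ranked-unfold e (neg ψ)    er rψ         = Ranked-unfold e ψ er rψ
    Ranked-unfold e (and ψ χ)  er (rψ , rχ)  = Ranked-unfold e ψ er rψ , Ranked-unfold e χ er rχ
    Ranked-unfold e (or ψ χ)   er (rψ , rχ)  = Ranked-unfold e ψ er rψ , Ranked-unfold e χ er rχ
    Ranked-unfold e (ex x ψ)   er rψ         = Ranked-unfold e ψ er rψ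
    Ranked-unfold e (all' x ψ) er rψ         = Ranked-unfold e ψ er rψ
    Ranked-unfold e (lab L ψ)  er (rank , rψ) = rank′ , Ranked-unfold e′ ψ er′ rψ
      where
      e′ : Label → Maybe (Formula V)
      e′ K = if K ≡ᵇ L then just (lab L ψ) else e K

      er′ : EnvRanked e′
      er′ K ξ eK with K ≡ᵇ L | ≡ᵇ-reflects K L | eK
      ... | true  | ofʸ refl | refl = (rank , rψ) , rank
      ... | false | ofⁿ _    | eK′  = er K ξ eK′

      rank′ : ∀ M → FreeIn M (lab L (unfold V e′ ψ)) → ι M < ι L
      rank′ M (under M≢L f) with FreeIn-unfold e′ ψ f
      ... | inj₁ f′ = rank M (under M≢L f′)
      ... | inj₂ (K , ξ , fK , eK , fM) with K ≡ᵇ L | ≡ᵇ-reflects K L | eK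
      ...   | true  | ofʸ refl | refl = rank M fM
      ...   | false | ofⁿ K≢L  | eK′  = <-trans (proj₂ (er K ξ eK′) M fM) (rank K (under K≢L fK))
    Ranked-unfold e (claim K) er _ with e K in eK
    ... | just ξ  = proj₁ (er K ξ eK)
    ... | nothing = tt

  -- an expanding position of Ψᵏ still pays for the claim move that Ψᵏ⁺¹ has unfolded
  Allowance : Mode → Budget → Budget → Set
  Allowance expanding β₁ β₂ = β₁ ≼ sucᴮ β₂
  Allowance copying   β₁ β₂ = β₁ ≼ β₂

  ≼⇒Allowance : ∀ m {β₁ β₂} → β₁ ≼ β₂ → Allowance m β₁ β₂
  ≼⇒Allowance expanding = ≼-sucᴮ
  ≼⇒Allowance copying   β₁≼β₂ = β₁≼β₂

  module _ {𝔄 : Structure V} (ι : Label → ℕ) where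

    mutual
      Wins-unfold⁺ : ∀ {β₁ β₂ st χ r s} → Wins 𝔄 β₁ st χ r s → WellRanked ι st χ → β₁ ≼ sucᴮ β₂
                   → Wins 𝔄 β₂ (unfoldStack st) (unfold V (env st) χ) r s
      Wins-unfold⁺ (relP h)       _  _ = relP h
      Wins-unfold⁺ (relN h)       _  _ = relN h
      Wins-unfold⁺ (eqP h)        _  _ = eqP h
      Wins-unfold⁺ (eqN h)        _  _ = eqN h
      Wins-unfold⁺ botN           _  _ = botN
      Wins-unfold⁺ (negW w)       wr b = negW (Wins-unfold⁺ w (WellRanked-◃ ι neg◃ wr) b)
      Wins-unfold⁺ (andP w w′)    wr b = andP (Wins-unfold⁺ w (WellRanked-◃ ι andˡ◃ wr) b)
                                              (Wins-unfold⁺ w′ (WellRanked-◃ ι andʳ◃ wr) b)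
      Wins-unfold⁺ (andNL w)      wr b = andNL (Wins-unfold⁺ w (WellRanked-◃ ι andˡ◃ wr) b)
      Wins-unfold⁺ (andNR w)      wr b = andNR (Wins-unfold⁺ w (WellRanked-◃ ι andʳ◃ wr) b)
      Wins-unfold⁺ (orPL w)       wr b = orPL (Wins-unfold⁺ w (WellRanked-◃ ι orˡ◃ wr) b)
      Wins-unfold⁺ (orPR w)       wr b = orPR (Wins-unfold⁺ w (WellRanked-◃ ι orʳ◃ wr) b)
      Wins-unfold⁺ (orN w w′)     wr b = orN (Wins-unfold⁺ w (WellRanked-◃ ι orˡ◃ wr) b)
                                             (Wins-unfold⁺ w′ (WellRanked-◃ ι orʳ◃ wr) b)
      Wins-unfold⁺ (allP f)       wr b = allP λ a → Wins-unfold⁺ (f a) (WellRanked-◃ ι all◃ wr) b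
      Wins-unfold⁺ (allN (a , w)) wr b = allN (a , Wins-unfold⁺ w (WellRanked-◃ ι all◃ wr) b)
      Wins-unfold⁺ (exP (a , w))  wr b = exP (a , Wins-unfold⁺ w (WellRanked-◃ ι ex◃ wr) b)
      Wins-unfold⁺ (exN f)        wr b = exN λ a → Wins-unfold⁺ (f a) (WellRanked-◃ ι ex◃ wr) b
      Wins-unfold⁺ (labW w)       wr b = labW (Wins-unfold⁺ w (WellRanked-lab ι wr) b)
      Wins-unfold⁺ {st = st} (claimW ↝β lk (labW w)) wr b rewrite env-ref st lk =
        labW (Wins-copy⁺ w (proj₁ copy) (proj₂ copy) (↝-≼-sucᴮ b ↝β))
        where copy = claim-copy ι wr lk

      Wins-copy⁺ : ∀ {β₁ β₂ st₁ st₂ χ r s} → Wins 𝔄 β₁ st₁ χ r s → WellRanked ι st₁ χ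
                 → Sim copying st₁ χ st₂ χ → β₁ ≼ β₂ → Wins 𝔄 β₂ st₂ χ r s
      Wins-copy⁺ (relP h)       _  _ _ = relP h
      Wins-copy⁺ (relN h)       _  _ _ = relN h
      Wins-copy⁺ (eqP h)        _  _ _ = eqP h
      Wins-copy⁺ (eqN h)        _  _ _ = eqN h
      Wins-copy⁺ botN           _  _ _ = botN
      Wins-copy⁺ (negW w)       wr c b = negW (Wins-copy⁺ w (WellRanked-◃ ι neg◃ wr) (copied-◃ neg◃ c) b)
      Wins-copy⁺ (andP w w′)    wr c b = andP (Wins-copy⁺ w (WellRanked-◃ ι andˡ◃ wr) (copied-◃ andˡ◃ c) b)
                                              (Wins-copy⁺ w′ (WellRanked-◃ ι andʳ◃ wr) (copied-◃ andʳ◃ c) b)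
      Wins-copy⁺ (andNL w)      wr c b = andNL (Wins-copy⁺ w (WellRanked-◃ ι andˡ◃ wr) (copied-◃ andˡ◃ c) b)
      Wins-copy⁺ (andNR w)      wr c b = andNR (Wins-copy⁺ w (WellRanked-◃ ι andʳ◃ wr) (copied-◃ andʳ◃ c) b)
      Wins-copy⁺ (orPL w)       wr c b = orPL (Wins-copy⁺ w (WellRanked-◃ ι orˡ◃ wr) (copied-◃ orˡ◃ c) b)
      Wins-copy⁺ (orPR w)       wr c b = orPR (Wins-copy⁺ w (WellRanked-◃ ι orʳ◃ wr) (copied-◃ orʳ◃ c) b)
      Wins-copy⁺ (orN w w′)     wr c b = orN (Wins-copy⁺ w (WellRanked-◃ ι orˡ◃ wr) (copied-◃ orˡ◃ c) b)
                                             (Wins-copy⁺ w′ (WellRanked-◃ ι orʳ◃ wr) (copied-◃ orʳ◃ c) b)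
      Wins-copy⁺ (allP f)       wr c b = allP λ a → Wins-copy⁺ (f a) (WellRanked-◃ ι all◃ wr) (copied-◃ all◃ c) b
      Wins-copy⁺ (allN (a , w)) wr c b = allN (a , Wins-copy⁺ w (WellRanked-◃ ι all◃ wr) (copied-◃ all◃ c) b)
      Wins-copy⁺ (exP (a , w))  wr c b = exP (a , Wins-copy⁺ w (WellRanked-◃ ι ex◃ wr) (copied-◃ ex◃ c) b)
      Wins-copy⁺ (exN f)        wr c b = exN λ a → Wins-copy⁺ (f a) (WellRanked-◃ ι ex◃ wr) (copied-◃ ex◃ c) b
      Wins-copy⁺ (labW w)       wr c b = labW (Wins-copy⁺ w (WellRanked-lab ι wr) (copied-lab c) b)
      Wins-copy⁺ {st₂ = st₂} (claimW {L = K} ↝β lk w) (_ , _ , rst) (copied refs) b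
        with lookup K st₂ in lk₂ | subst (λ l → SimRef K l (lookup K st₂)) lk (refs K here)
      ... | just _ | some {m} sim with ↝-mono b ↝β
      ...   | _ , ↝β₂ , b′ = claimW ↝β₂ lk₂ (Wins-sim⁺ m w (WellRanked-ref ι rst lk) sim (≼⇒Allowance m b′))

      Wins-sim⁺ : ∀ m {β₁ β₂ st₁ st₂ χ₁ χ₂ r s} → Wins 𝔄 β₁ st₁ χ₁ r s → WellRanked ι st₁ χ₁
                → Sim m st₁ χ₁ st₂ χ₂ → Allowance m β₁ β₂ → Wins 𝔄 β₂ st₂ χ₂ r s
      Wins-sim⁺ expanding w wr expanded    b = Wins-unfold⁺ w wr b
      Wins-sim⁺ copying   w wr (copied refs) b = Wins-copy⁺ w wr (copied refs) b

    mutual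
      Wins-unfold⁻ : ∀ {β st r s} χ → Wins 𝔄 β (unfoldStack st) (unfold V (env st) χ) r s
                   → WellRanked ι st χ → Wins 𝔄 ∞ st χ r s
      Wins-unfold⁻ (rel R xs) (relP h)       _  = relP h
      Wins-unfold⁻ (rel R xs) (relN h)       _  = relN h
      Wins-unfold⁻ (eq x y)   (eqP h)        _  = eqP h
      Wins-unfold⁻ (eq x y)   (eqN h)        _  = eqN h
      Wins-unfold⁻ bot        botN           _  = botN
      Wins-unfold⁻ (neg ψ)    (negW w)       wr = negW (Wins-unfold⁻ ψ w (WellRanked-◃ ι neg◃ wr))
      Wins-unfold⁻ (and ψ χ)  (andP w w′)    wr = andP (Wins-unfold⁻ ψ w (WellRanked-◃ ι andˡ◃ wr))
                                                       (Wins-unfold⁻ χ w′ (WellRanked-◃ ι andʳ◃ wr))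
      Wins-unfold⁻ (and ψ χ)  (andNL w)      wr = andNL (Wins-unfold⁻ ψ w (WellRanked-◃ ι andˡ◃ wr))
      Wins-unfold⁻ (and ψ χ)  (andNR w)      wr = andNR (Wins-unfold⁻ χ w (WellRanked-◃ ι andʳ◃ wr))
      Wins-unfold⁻ (or ψ χ)   (orPL w)       wr = orPL (Wins-unfold⁻ ψ w (WellRanked-◃ ι orˡ◃ wr))
      Wins-unfold⁻ (or ψ χ)   (orPR w)       wr = orPR (Wins-unfold⁻ χ w (WellRanked-◃ ι orʳ◃ wr))
      Wins-unfold⁻ (or ψ χ)   (orN w w′)     wr = orN (Wins-unfold⁻ ψ w (WellRanked-◃ ι orˡ◃ wr))
                                                      (Wins-unfold⁻ χ w′ (WellRanked-◃ ι orʳ◃ wr))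
      Wins-unfold⁻ (all' x ψ) (allP f)       wr = allP λ a → Wins-unfold⁻ ψ (f a) (WellRanked-◃ ι all◃ wr)
      Wins-unfold⁻ (all' x ψ) (allN (a , w)) wr = allN (a , Wins-unfold⁻ ψ w (WellRanked-◃ ι all◃ wr))
      Wins-unfold⁻ (ex x ψ)   (exP (a , w))  wr = exP (a , Wins-unfold⁻ ψ w (WellRanked-◃ ι ex◃ wr))
      Wins-unfold⁻ (ex x ψ)   (exN f)        wr = exN λ a → Wins-unfold⁻ ψ (f a) (WellRanked-◃ ι ex◃ wr)
      Wins-unfold⁻ (lab L ψ)  (labW w)       wr = labW (Wins-unfold⁻ ψ w (WellRanked-lab ι wr))
      Wins-unfold⁻ {st = st} (claim K) w wr
        with lookup K st in lk | env st K | env≡lookup st K | expanded-ref K st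
      ... | just _  | _ | refl | _ with w
      ...   | labW w′ = claimW ∞↝∞ lk (labW (Wins-copy⁻ w′ (proj₁ copy) (proj₂ copy)))
        where copy = claim-copy ι wr lk
      Wins-unfold⁻ (claim K) w _ | nothing | _ | refl | ref with w
      ...   | claimW _ lk₂ _ with trans (sym lk₂) (SimRef-nothing ref)
      ...     | ()

      Wins-copy⁻ : ∀ {β st₁ st₂ χ r s} → Wins 𝔄 β st₂ χ r s → WellRanked ι st₁ χ
                 → Sim copying st₁ χ st₂ χ → Wins 𝔄 ∞ st₁ χ r s
      Wins-copy⁻ (relP h)       _  _ = relP h
      Wins-copy⁻ (relN h)       _  _ = relN h
      Wins-copy⁻ (eqP h)        _  _ = eqP h
      Wins-copy⁻ (eqN h)        _  _ = eqN h
      Wins-copy⁻ botN           _  _ = botN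
      Wins-copy⁻ (negW w)       wr c = negW (Wins-copy⁻ w (WellRanked-◃ ι neg◃ wr) (copied-◃ neg◃ c))
      Wins-copy⁻ (andP w w′)    wr c = andP (Wins-copy⁻ w (WellRanked-◃ ι andˡ◃ wr) (copied-◃ andˡ◃ c))
                                            (Wins-copy⁻ w′ (WellRanked-◃ ι andʳ◃ wr) (copied-◃ andʳ◃ c))
      Wins-copy⁻ (andNL w)      wr c = andNL (Wins-copy⁻ w (WellRanked-◃ ι andˡ◃ wr) (copied-◃ andˡ◃ c))
      Wins-copy⁻ (andNR w)      wr c = andNR (Wins-copy⁻ w (WellRanked-◃ ι andʳ◃ wr) (copied-◃ andʳ◃ c))
      Wins-copy⁻ (orPL w)       wr c = orPL (Wins-copy⁻ w (WellRanked-◃ ι orˡ◃ wr) (copied-◃ orˡ◃ c))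
      Wins-copy⁻ (orPR w)       wr c = orPR (Wins-copy⁻ w (WellRanked-◃ ι orʳ◃ wr) (copied-◃ orʳ◃ c))
      Wins-copy⁻ (orN w w′)     wr c = orN (Wins-copy⁻ w (WellRanked-◃ ι orˡ◃ wr) (copied-◃ orˡ◃ c))
                                           (Wins-copy⁻ w′ (WellRanked-◃ ι orʳ◃ wr) (copied-◃ orʳ◃ c))
      Wins-copy⁻ (allP f)       wr c = allP λ a → Wins-copy⁻ (f a) (WellRanked-◃ ι all◃ wr) (copied-◃ all◃ c)
      Wins-copy⁻ (allN (a , w)) wr c = allN (a , Wins-copy⁻ w (WellRanked-◃ ι all◃ wr) (copied-◃ all◃ c))
      Wins-copy⁻ (exP (a , w))  wr c = exP (a , Wins-copy⁻ w (WellRanked-◃ ι ex◃ wr) (copied-◃ ex◃ c))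
      Wins-copy⁻ (exN f)        wr c = exN λ a → Wins-copy⁻ (f a) (WellRanked-◃ ι ex◃ wr) (copied-◃ ex◃ c)
      Wins-copy⁻ (labW w)       wr c = labW (Wins-copy⁻ w (WellRanked-lab ι wr) (copied-lab c))
      Wins-copy⁻ {st₁ = st₁} (claimW {L = K} _ lk₂ w) (_ , _ , rst) (copied refs)
        with lookup K st₁ in lk | subst (SimRef K (lookup K st₁)) lk₂ (refs K here)
      ... | just _ | some {m} sim = claimW ∞↝∞ lk (Wins-sim⁻ m w (WellRanked-ref ι rst lk) sim)

      Wins-sim⁻ : ∀ m {β st₁ st₂ χ₁ χ₂ r s} → Wins 𝔄 β st₂ χ₂ r s → WellRanked ι st₁ χ₁
                → Sim m st₁ χ₁ st₂ χ₂ → Wins 𝔄 ∞ st₁ χ₁ r s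
      Wins-sim⁻ expanding w wr expanded      = Wins-unfold⁻ _ w wr
      Wins-sim⁻ copying   w wr (copied refs) = Wins-copy⁻ w wr (copied refs)

  Ranked-Ψ : ∀ ι φ k → Ranked ι (Ψ V 0 φ) → Ranked ι (Ψ V k φ)
  Ranked-Ψ ι φ zero    r = r
  Ranked-Ψ ι φ (suc k) r = Ranked-unfold ι (λ _ → nothing) (Ψ V k φ) (λ _ _ ()) (Ranked-Ψ ι φ k r)

  module _ {𝔄 : Structure V} (ι : Label → ℕ) (φ : Formula V) (ranked : Ranked ι (Ψ V 0 φ)) where

    private
      wr : ∀ k → WellRanked ι [] (Ψ V k φ)
      wr k = Ranked-Ψ ι φ k ranked , (λ _ _ → tt) , tt

    Wins-Ψ⁺ : ∀ n {r s} → Wins 𝔄 (fin n) [] (Ψ V 0 φ) r s → Wins 𝔄 (fin 0) [] (Ψ V n φ) r s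
    Wins-Ψ⁺ n {r} {s} w = subst (λ i → Wins 𝔄 (fin 0) [] (Ψ V i φ) r s) (+-identityʳ n) (go n 0 w)
      where
      go : ∀ n k → Wins 𝔄 (fin n) [] (Ψ V k φ) r s → Wins 𝔄 (fin 0) [] (Ψ V (n ℕ.+ k) φ) r s
      go zero    k w = w
      go (suc n) k w = subst (λ i → Wins 𝔄 (fin 0) [] (Ψ V i φ) r s) (+-suc n k)
                             (go n (suc k) (Wins-unfold⁺ ι w (wr k) (fin≼ ≤-refl)))

    Wins-Ψ⁻ : ∀ k {β r s} → Wins 𝔄 β [] (Ψ V k φ) r s → Wins 𝔄 ∞ [] (Ψ V 0 φ) r s
    Wins-Ψ⁻ zero    w = Wins-mono ≼∞ w
    Wins-Ψ⁻ (suc k) w = Wins-Ψ⁻ k (Wins-unfold⁻ ι (Ψ V k φ) w (wr k))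

  -- Renaming

  ren : (Label → Maybe Label) → Label → Formula V → Formula V
  ren ρ c χ = proj₁ (rename V ρ c χ)

  next : (Label → Maybe Label) → Label → Formula V → Label
  next ρ c χ = proj₂ (rename V ρ c χ)

  extend : (Label → Maybe Label) → Label → Label → Label → Maybe Label
  extend ρ L c K = if K ≡ᵇ L then just c else ρ K

  extend-≡ : ∀ ρ L c → extend ρ L c L ≡ just c
  extend-≡ ρ L c with L ≡ᵇ L | ≡ᵇ-reflects L L
  ... | true  | _       = refl
  ... | false | ofⁿ L≢L = ⊥-elim (L≢L refl)

  extend-≢ : ∀ ρ {L K} c → K ≢ L → extend ρ L c K ≡ ρ K
  extend-≢ ρ {L} {K} c K≢L with K ≡ᵇ L | ≡ᵇ-reflects K L
  ... | true  | ofʸ K≡L = ⊥-elim (K≢L K≡L)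
  ... | false | _       = refl

  extend-just : ∀ ρ {L K c M} → extend ρ L c K ≡ just M → M ≢ c → ρ K ≡ just M
  extend-just ρ {L} {K} ρ′K M≢c with K ≡ᵇ L | ρ′K
  ... | true  | refl = ⊥-elim (M≢c refl)
  ... | false | ρK   = ρK

  next-≥ : ∀ ρ c χ → c ≤ next ρ c χ
  next-≥ ρ c (rel R xs) = ≤-refl
  next-≥ ρ c (eq x y)   = ≤-refl
  next-≥ ρ c bot        = ≤-refl
  next-≥ ρ c (neg χ)    = next-≥ ρ c χ
  next-≥ ρ c (and ψ χ)  = ≤-trans (next-≥ ρ c ψ) (next-≥ ρ (next ρ c ψ) χ)
  next-≥ ρ c (or ψ χ)   = ≤-trans (next-≥ ρ c ψ) (next-≥ ρ (next ρ c ψ) χ)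
  next-≥ ρ c (ex x χ)   = next-≥ ρ c χ
  next-≥ ρ c (all' x χ) = next-≥ ρ c χ
  next-≥ ρ c (lab L χ)  = ≤-trans (n≤1+n c) (next-≥ (extend ρ L c) (suc c) χ)
  next-≥ ρ c (claim K) with ρ K
  ... | just _  = ≤-refl
  ... | nothing = ≤-refl

  Claims≤ : ℕ → Formula V → Set
  Claims≤ m (neg ψ)    = Claims≤ m ψ
  Claims≤ m (and ψ χ)  = Claims≤ m ψ × Claims≤ m χ
  Claims≤ m (or ψ χ)   = Claims≤ m ψ × Claims≤ m χ
  Claims≤ m (ex x ψ)   = Claims≤ m ψ
  Claims≤ m (all' x ψ) = Claims≤ m ψ
  Claims≤ m (lab L ψ)  = Claims≤ m ψ
  Claims≤ m (claim K)  = K ≤ m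
  Claims≤ m _          = ⊤

  Claims≤-mono : ∀ {m n} χ → m ≤ n → Claims≤ m χ → Claims≤ n χ
  Claims≤-mono (rel R xs) _   _          = tt
  Claims≤-mono (eq x y)   _   _          = tt
  Claims≤-mono bot        _   _          = tt
  Claims≤-mono (neg ψ)    m≤n cψ         = Claims≤-mono ψ m≤n cψ
  Claims≤-mono (and ψ χ)  m≤n (cψ , cχ)  = Claims≤-mono ψ m≤n cψ , Claims≤-mono χ m≤n cχ
  Claims≤-mono (or ψ χ)   m≤n (cψ , cχ)  = Claims≤-mono ψ m≤n cψ , Claims≤-mono χ m≤n cχ
  Claims≤-mono (ex x ψ)   m≤n cψ         = Claims≤-mono ψ m≤n cψ
  Claims≤-mono (all' x ψ) m≤n cψ         = Claims≤-mono ψ m≤n cψ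
  Claims≤-mono (lab L ψ)  m≤n cψ         = Claims≤-mono ψ m≤n cψ
  Claims≤-mono (claim K)  m≤n K≤m        = ≤-trans K≤m m≤n

  Claims≤-maxIdx : ∀ χ → Claims≤ (maxIdx V χ) χ
  Claims≤-maxIdx (rel R xs) = tt
  Claims≤-maxIdx (eq x y)   = tt
  Claims≤-maxIdx bot        = tt
  Claims≤-maxIdx (neg ψ)    = Claims≤-maxIdx ψ
  Claims≤-maxIdx (and ψ χ)  = Claims≤-mono ψ (m≤m⊔n _ _) (Claims≤-maxIdx ψ) , Claims≤-mono χ (m≤n⊔m _ _) (Claims≤-maxIdx χ)
  Claims≤-maxIdx (or ψ χ)   = Claims≤-mono ψ (m≤m⊔n _ _) (Claims≤-maxIdx ψ) , Claims≤-mono χ (m≤n⊔m _ _) (Claims≤-maxIdx χ)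
  Claims≤-maxIdx (ex x ψ)   = Claims≤-maxIdx ψ
  Claims≤-maxIdx (all' x ψ) = Claims≤-maxIdx ψ
  Claims≤-maxIdx (lab L ψ)  = Claims≤-mono ψ (m≤n⊔m L _) (Claims≤-maxIdx ψ)
  Claims≤-maxIdx (claim K)  = ≤-refl

  -- m bounds the label indices of the formula being renamed
  module _ (m : ℕ) where

    Fresh : (Label → Maybe Label) → Label → Set
    Fresh ρ c = m < c × (∀ K {c′} → ρ K ≡ just c′ → c′ < c)

    Fresh-≤ : ∀ {ρ c c′} → Fresh ρ c → c ≤ c′ → Fresh ρ c′
    Fresh-≤ (m<c , ρ<c) c≤c′ = <-≤-trans m<c c≤c′ , λ K ρK → <-≤-trans (ρ<c K ρK) c≤c′

    Fresh-next : ∀ {ρ c} χ → Fresh ρ c → Fresh ρ (next ρ c χ)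
    Fresh-next {ρ} {c} χ fr = Fresh-≤ fr (next-≥ ρ c χ)

    Fresh-extend : ∀ {ρ c} L → Fresh ρ c → Fresh (extend ρ L c) (suc c)
    Fresh-extend {ρ} {c} L (m<c , ρ<c) = m≤n⇒m≤1+n m<c , ρ′<c
      where
      ρ′<c : ∀ K {c′} → extend ρ L c K ≡ just c′ → c′ < suc c
      ρ′<c K ρ′K with K ≡ᵇ L | ρ′K
      ... | true  | refl = ≤-refl
      ... | false | ρK   = m≤n⇒m≤1+n (ρ<c K ρK)

    -- st₂ is the renamed copy of st₁, and ρ sends the labels of st₁ to their new names
    data RenStack : Stack → Stack → (Label → Maybe Label) → Set where
      []  : ∀ {ρ} → (∀ K → ρ K ≡ nothing) → RenStack [] [] ρ
      _∷_ : ∀ {st₁ st₂ ρ L ψ c} → Fresh ρ c × Claims≤ m ψ → RenStack st₁ st₂ ρ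
          → RenStack ((L , ψ) ∷ st₁) ((c , ren (extend ρ L c) (suc c) ψ) ∷ st₂) (extend ρ L c)

    data RenRef (K : Label) (ρ : Label → Maybe Label) (st₂ : Stack) : Maybe (Formula V × Stack) → Set where
      none : ρ K ≡ nothing → RenRef K ρ st₂ nothing
      some : ∀ {ψ rest₁ rest₂ ρ₀ c} → ρ K ≡ just c
           → lookup c st₂ ≡ just (ren (extend ρ₀ K c) (suc c) ψ , rest₂)
           → Fresh ρ₀ c × Claims≤ m ψ → RenStack rest₁ rest₂ ρ₀ → RenRef K ρ st₂ (just (ψ , rest₁))

    RenStack-ref : ∀ {st₁ st₂ ρ} → RenStack st₁ st₂ ρ → ∀ K → RenRef K ρ st₂ (lookup K st₁)
    RenStack-ref ([] ρ≡nothing) K = none (ρ≡nothing K)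
    RenStack-ref (_∷_ {st₁} {st₂} {ρ} {L} {ψ} {c} fc rs) K
      with L ≟ K
    ... | yes refl = some (extend-≡ ρ L c) (lookup-head c _ st₂) fc rs
    ... | no L≢K   with lookup K st₁ | RenStack-ref rs K
    ...   | _ | none ρK = none (trans (extend-≢ ρ c (L≢K ∘ sym)) ρK)
    ...   | _ | some ρK lk fc′ rs′ =
      some (trans (extend-≢ ρ c (L≢K ∘ sym)) ρK)
           (trans (lookup-tail _ st₂ λ c≡c′ → <-irrefl (sym c≡c′) (proj₂ (proj₁ fc) K ρK)) lk) fc′ rs′

    lookup-original : ∀ {st₁ st₂ ρ K} → RenStack st₁ st₂ ρ → K ≤ m → lookup K st₂ ≡ nothing
    lookup-original ([] _) _ = refl
    lookup-original {K = K} (_∷_ {st₂ = st₂} {c = c} ((m<c , _) , _) rs) K≤m with c ≟ K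
    ... | yes refl = ⊥-elim (<-irrefl refl (<-≤-trans m<c K≤m))
    ... | no _     = lookup-original rs K≤m

    module _ {𝔄 : Structure V} where

      Wins-rename⁺ : ∀ {β st₁ st₂ ρ c χ r s} → Wins 𝔄 β st₁ χ r s → RenStack st₁ st₂ ρ → Fresh ρ c
                   → Claims≤ m χ → Wins 𝔄 β st₂ (ren ρ c χ) r s
      Wins-rename⁺ (relP h)       _  _  _ = relP h
      Wins-rename⁺ (relN h)       _  _  _ = relN h
      Wins-rename⁺ (eqP h)        _  _  _ = eqP h
      Wins-rename⁺ (eqN h)        _  _  _ = eqN h
      Wins-rename⁺ botN           _  _  _ = botN
      Wins-rename⁺ (negW w)       rs fr cl = negW (Wins-rename⁺ w rs fr cl)
      Wins-rename⁺ (andP {ψ = ψ} w w′) rs fr (cψ , cχ) =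
        andP (Wins-rename⁺ w rs fr cψ) (Wins-rename⁺ w′ rs (Fresh-next ψ fr) cχ)
      Wins-rename⁺ (andNL w)      rs fr (cψ , _) = andNL (Wins-rename⁺ w rs fr cψ)
      Wins-rename⁺ (andNR {ψ = ψ} w) rs fr (_ , cχ) = andNR (Wins-rename⁺ w rs (Fresh-next ψ fr) cχ)
      Wins-rename⁺ (orPL w)       rs fr (cψ , _) = orPL (Wins-rename⁺ w rs fr cψ)
      Wins-rename⁺ (orPR {ψ = ψ} w) rs fr (_ , cχ) = orPR (Wins-rename⁺ w rs (Fresh-next ψ fr) cχ)
      Wins-rename⁺ (orN {ψ = ψ} w w′) rs fr (cψ , cχ) =
        orN (Wins-rename⁺ w rs fr cψ) (Wins-rename⁺ w′ rs (Fresh-next ψ fr) cχ)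
      Wins-rename⁺ (allP f)       rs fr cl = allP λ a → Wins-rename⁺ (f a) rs fr cl
      Wins-rename⁺ (allN (a , w)) rs fr cl = allN (a , Wins-rename⁺ w rs fr cl)
      Wins-rename⁺ (exP (a , w))  rs fr cl = exP (a , Wins-rename⁺ w rs fr cl)
      Wins-rename⁺ (exN f)        rs fr cl = exN λ a → Wins-rename⁺ (f a) rs fr cl
      Wins-rename⁺ (labW {L = L} w) rs fr cl = labW (Wins-rename⁺ w ((fr , cl) ∷ rs) (Fresh-extend L fr) cl)
      Wins-rename⁺ (claimW {L = K} ↝β lk w) rs _ _
        with subst (RenRef K _ _) lk (RenStack-ref rs K)
      ... | some ρK lk₂ (fr , cl) rs′ rewrite ρK = claimW ↝β lk₂ (Wins-rename⁺ w rs′ fr cl)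

      Wins-rename⁻ : ∀ {β st₁ st₂ ρ c r s} χ → Wins 𝔄 β st₂ (ren ρ c χ) r s → RenStack st₁ st₂ ρ
                   → Fresh ρ c → Claims≤ m χ → Wins 𝔄 β st₁ χ r s
      Wins-rename⁻ (rel R xs) (relP h)       _  _  _ = relP h
      Wins-rename⁻ (rel R xs) (relN h)       _  _  _ = relN h
      Wins-rename⁻ (eq x y)   (eqP h)        _  _  _ = eqP h
      Wins-rename⁻ (eq x y)   (eqN h)        _  _  _ = eqN h
      Wins-rename⁻ bot        botN           _  _  _ = botN
      Wins-rename⁻ (neg ψ)    (negW w)       rs fr cl = negW (Wins-rename⁻ ψ w rs fr cl)
      Wins-rename⁻ (and ψ χ)  (andP w w′)    rs fr (cψ , cχ) =
        andP (Wins-rename⁻ ψ w rs fr cψ) (Wins-rename⁻ χ w′ rs (Fresh-next ψ fr) cχ)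
      Wins-rename⁻ (and ψ χ)  (andNL w)      rs fr (cψ , _) = andNL (Wins-rename⁻ ψ w rs fr cψ)
      Wins-rename⁻ (and ψ χ)  (andNR w)      rs fr (_ , cχ) = andNR (Wins-rename⁻ χ w rs (Fresh-next ψ fr) cχ)
      Wins-rename⁻ (or ψ χ)   (orPL w)       rs fr (cψ , _) = orPL (Wins-rename⁻ ψ w rs fr cψ)
      Wins-rename⁻ (or ψ χ)   (orPR w)       rs fr (_ , cχ) = orPR (Wins-rename⁻ χ w rs (Fresh-next ψ fr) cχ)
      Wins-rename⁻ (or ψ χ)   (orN w w′)     rs fr (cψ , cχ) =
        orN (Wins-rename⁻ ψ w rs fr cψ) (Wins-rename⁻ χ w′ rs (Fresh-next ψ fr) cχ)
      Wins-rename⁻ (all' x ψ) (allP f)       rs fr cl = allP λ a → Wins-rename⁻ ψ (f a) rs fr cl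
      Wins-rename⁻ (all' x ψ) (allN (a , w)) rs fr cl = allN (a , Wins-rename⁻ ψ w rs fr cl)
      Wins-rename⁻ (ex x ψ)   (exP (a , w))  rs fr cl = exP (a , Wins-rename⁻ ψ w rs fr cl)
      Wins-rename⁻ (ex x ψ)   (exN f)        rs fr cl = exN λ a → Wins-rename⁻ ψ (f a) rs fr cl
      Wins-rename⁻ (lab L ψ)  (labW w)       rs fr cl = labW (Wins-rename⁻ ψ w ((fr , cl) ∷ rs) (Fresh-extend L fr) cl)
      Wins-rename⁻ {st₁ = st₁} (claim K) w rs _ K≤m with lookup K st₁ in lk | RenStack-ref rs K
      ... | nothing | none ρK rewrite ρK with w
      ...   | claimW _ lk₂ _ with trans (sym lk₂) (lookup-original rs K≤m)
      ...     | ()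
      Wins-rename⁻ (claim K) w rs _ _ | just _ | some ρK lk₂ (fr , cl) rs′ rewrite ρK with w
      ...   | claimW ↝β lk₃ w′ with trans (sym lk₃) lk₂
      ...     | refl = claimW ↝β lk (Wins-rename⁻ (lab K _) w′ rs′ fr cl)

    FreeIn-ren : ∀ ρ c χ {M} → Claims≤ m χ → FreeIn M (ren ρ c χ) → (∃ λ K → ρ K ≡ just M) ⊎ M ≤ m
    FreeIn-ren ρ c (rel R xs) _ (sub () _)
    FreeIn-ren ρ c (eq x y)   _ (sub () _)
    FreeIn-ren ρ c bot        _ (sub () _)
    FreeIn-ren ρ c (neg ψ)    cl        (sub neg◃ f)  = FreeIn-ren ρ c ψ cl f
    FreeIn-ren ρ c (and ψ χ)  (cψ , _)  (sub andˡ◃ f) = FreeIn-ren ρ c ψ cψ f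
    FreeIn-ren ρ c (and ψ χ)  (_ , cχ)  (sub andʳ◃ f) = FreeIn-ren ρ (next ρ c ψ) χ cχ f
    FreeIn-ren ρ c (or ψ χ)   (cψ , _)  (sub orˡ◃ f)  = FreeIn-ren ρ c ψ cψ f
    FreeIn-ren ρ c (or ψ χ)   (_ , cχ)  (sub orʳ◃ f)  = FreeIn-ren ρ (next ρ c ψ) χ cχ f
    FreeIn-ren ρ c (ex x ψ)   cl        (sub ex◃ f)   = FreeIn-ren ρ c ψ cl f
    FreeIn-ren ρ c (all' x ψ) cl        (sub all◃ f)  = FreeIn-ren ρ c ψ cl f
    FreeIn-ren ρ c (lab L ψ)  cl        (under M≢c f) with FreeIn-ren (extend ρ L c) (suc c) ψ cl f
    ... | inj₁ (K , ρ′K) = inj₁ (K , extend-just ρ ρ′K M≢c)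
    ... | inj₂ M≤m       = inj₂ M≤m
    FreeIn-ren ρ c (claim K)  K≤m f with ρ K in ρK | f
    ... | just _  | here = inj₁ (K , ρK)
    ... | nothing | here = inj₂ K≤m

    Ranked-ren : ∀ ρ c χ → Fresh ρ c → Claims≤ m χ → Ranked (λ K → K) (ren ρ c χ)
    Ranked-ren ρ c (rel R xs) _  _         = tt
    Ranked-ren ρ c (eq x y)   _  _         = tt
    Ranked-ren ρ c bot        _  _         = tt
    Ranked-ren ρ c (neg ψ)    fr cl        = Ranked-ren ρ c ψ fr cl
    Ranked-ren ρ c (and ψ χ)  fr (cψ , cχ) = Ranked-ren ρ c ψ fr cψ , Ranked-ren ρ (next ρ c ψ) χ (Fresh-next ψ fr) cχ
    Ranked-ren ρ c (or ψ χ)   fr (cψ , cχ) = Ranked-ren ρ c ψ fr cψ , Ranked-ren ρ (next ρ c ψ) χ (Fresh-next ψ fr) cχ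
    Ranked-ren ρ c (ex x ψ)   fr cl        = Ranked-ren ρ c ψ fr cl
    Ranked-ren ρ c (all' x ψ) fr cl        = Ranked-ren ρ c ψ fr cl
    Ranked-ren ρ c (lab L ψ)  fr@(m<c , ρ<c) cl = rank , Ranked-ren (extend ρ L c) (suc c) ψ (Fresh-extend L fr) cl
      where
      rank : ∀ M → FreeIn M (lab c (ren (extend ρ L c) (suc c) ψ)) → M < c
      rank M (under M≢c f) with FreeIn-ren (extend ρ L c) (suc c) ψ cl f
      ... | inj₁ (K , ρ′K) = ρ<c K (extend-just ρ ρ′K M≢c)
      ... | inj₂ M≤m       = ≤-<-trans M≤m m<c
    Ranked-ren ρ c (claim K) _ _ with ρ K
    ... | just _  = tt
    ... | nothing = tt

  -- Regular formulas

  elem⇒∈ : ∀ {M} Ls → T (elem V M Ls) → M ∈ Ls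
  elem⇒∈ {M} Ls t = Any.map (≡ᵇ⇒≡ M _) (any⁻ _ Ls t)

  ∈⇒elem : ∀ {M Ls} → M ∈ Ls → T (elem V M Ls)
  ∈⇒elem {M} M∈ = any⁺ _ (Any.map (≡⇒≡ᵇ M _) M∈)

  noDup⇒∉ : ∀ pre {P rest} → T (noDup V (pre ++ P ∷ rest)) → P ∉ pre
  noDup⇒∉ (L ∷ pre) {P} {rest} t (here refl) =
    subst T (Equivalence.to T-not-≡ (proj₁ (Equivalence.to T-∧ t))) (∈⇒elem (∈-++⁺ʳ pre (here refl)))
  noDup⇒∉ (L ∷ pre) t (there P∈) = noDup⇒∉ pre (proj₂ (Equivalence.to T-∧ t)) P∈

  FreeIn⇒freeClaims : ∀ {M χ} b → FreeIn M χ → M ∉ b → M ∈ freeClaims V b χ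
  FreeIn⇒freeClaims {M} b here M∉b with elem V M b in isElem
  ... | true  = ⊥-elim (M∉b (elem⇒∈ b (subst T (sym isElem) tt)))
  ... | false = here refl
  FreeIn⇒freeClaims b (sub neg◃ f)  M∉b = FreeIn⇒freeClaims b f M∉b
  FreeIn⇒freeClaims b (sub andˡ◃ f) M∉b = ∈-++⁺ˡ (FreeIn⇒freeClaims b f M∉b)
  FreeIn⇒freeClaims b (sub (andʳ◃ {ψ}) f) M∉b = ∈-++⁺ʳ (freeClaims V b ψ) (FreeIn⇒freeClaims b f M∉b)
  FreeIn⇒freeClaims b (sub orˡ◃ f)  M∉b = ∈-++⁺ˡ (FreeIn⇒freeClaims b f M∉b)
  FreeIn⇒freeClaims b (sub (orʳ◃ {ψ}) f) M∉b = ∈-++⁺ʳ (freeClaims V b ψ) (FreeIn⇒freeClaims b f M∉b)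
  FreeIn⇒freeClaims b (sub ex◃ f)   M∉b = FreeIn⇒freeClaims b f M∉b
  FreeIn⇒freeClaims b (sub all◃ f)  M∉b = FreeIn⇒freeClaims b f M∉b
  FreeIn⇒freeClaims b (under {L} M≢L f) M∉b = FreeIn⇒freeClaims (L ∷ b) f M∉L∷b
    where
    M∉L∷b : _ ∉ L ∷ b
    M∉L∷b (here M≡L)  = M≢L M≡L
    M∉L∷b (there M∈b) = M∉b M∈b

  firstIndex : Label → List Label → Maybe ℕ
  firstIndex M []       = nothing
  firstIndex M (L ∷ Ls) = if M ≡ᵇ L then just 0 else Maybe.map suc (firstIndex M Ls)

  firstIndex-∉ : ∀ {M} Ls → M ∉ Ls → firstIndex M Ls ≡ nothing
  firstIndex-∉ []           _   = refl
  firstIndex-∉ {M} (L ∷ Ls) M∉ with M ≡ᵇ L | ≡ᵇ-reflects M L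
  ... | true  | ofʸ refl = ⊥-elim (M∉ (here refl))
  ... | false | _ rewrite firstIndex-∉ Ls (M∉ ∘ there) = refl

  firstIndex-∈ : ∀ {M} pre rest → M ∈ pre → ∃ λ i → firstIndex M (pre ++ rest) ≡ just i × i < length pre
  firstIndex-∈ {M} (L ∷ pre) rest M∈ with M ≡ᵇ L | ≡ᵇ-reflects M L | M∈
  ... | true  | _       | _          = 0 , refl , s≤s z≤n
  ... | false | ofⁿ M≢L | here M≡L   = ⊥-elim (M≢L M≡L)
  ... | false | _       | there M∈pre with firstIndex-∈ pre rest M∈pre
  ...   | i , idx , i< rewrite idx = suc i , refl , s≤s i<

  firstIndex-at : ∀ pre {P rest} → P ∉ pre → firstIndex P (pre ++ P ∷ rest) ≡ just (length pre)
  firstIndex-at [] {P} _ with P ≡ᵇ P | ≡ᵇ-reflects P P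
  ... | true  | _       = refl
  ... | false | ofⁿ P≢P = ⊥-elim (P≢P refl)
  firstIndex-at (L ∷ pre) {P} {rest} P∉ with P ≡ᵇ L | ≡ᵇ-reflects P L
  ... | true  | ofʸ refl = ⊥-elim (P∉ (here refl))
  ... | false | _ rewrite firstIndex-at pre {P} {rest} (P∉ ∘ there) = refl

  labelRank : Formula V → Label → ℕ
  labelRank φ M = Maybe.maybe suc 0 (firstIndex M (labelsOf V φ))

  module _ (φ : Formula V) (reg : isRegular V φ ≡ true) where

    private
      regular : T (noDup V (labelsOf V φ)) × T (all (λ L → not (elem V L (freeClaims V [] φ))) (labelsOf V φ))
      regular = Equivalence.to T-∧ (subst T (sym reg) tt)

    free∉labels : ∀ {M} → FreeIn M φ → M ∉ labelsOf V φ
    free∉labels f M∈ = subst T (Equivalence.to T-not-≡ (All.lookup (all⁺ _ _ (proj₂ regular)) M∈))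
                             (∈⇒elem (FreeIn⇒freeClaims [] f λ ()))

    firstIndex-label : ∀ pre {P rest} → labelsOf V φ ≡ pre ++ P ∷ rest
                     → firstIndex P (labelsOf V φ) ≡ just (length pre)
    firstIndex-label pre {P} ls =
      trans (cong (firstIndex P) ls) (firstIndex-at pre (noDup⇒∉ pre (subst (T ∘ noDup V) ls (proj₁ regular))))

    labelRank-< : ∀ pre {P rest M} → labelsOf V φ ≡ pre ++ P ∷ rest → M ∈ pre ⊎ FreeIn M φ
                → labelRank φ M < labelRank φ P
    labelRank-< pre {M = M} ls M∈pre⊎free rewrite firstIndex-label pre ls with M∈pre⊎free
    ... | inj₂ fφ rewrite firstIndex-∉ _ (free∉labels fφ) = s≤s z≤n
    ... | inj₁ M∈ with firstIndex-∈ pre _ M∈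
    ...   | i , idx , i< rewrite trans (cong (firstIndex M) ls) idx = s≤s i<

    -- Labels enclosing a labelled subformula come earlier in the preorder list, and in a
    -- regular formula the claims free in the whole formula are not labels at all.
    Ranked-within : ∀ χ pre post → labelsOf V φ ≡ pre ++ labelsOf V χ ++ post
                  → (∀ M → FreeIn M χ → M ∈ pre ⊎ FreeIn M φ) → Ranked (labelRank φ) χ
    Ranked-within (rel R xs) _   _    _  _ = tt
    Ranked-within (eq x y)   _   _    _  _ = tt
    Ranked-within bot        _   _    _  _ = tt
    Ranked-within (claim K)  _   _    _  _ = tt
    Ranked-within (neg ψ)    pre post ls h = Ranked-within ψ pre post ls λ M → h M ∘ sub neg◃
    Ranked-within (ex x ψ)   pre post ls h = Ranked-within ψ pre post ls λ M → h M ∘ sub ex◃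
    Ranked-within (all' x ψ) pre post ls h = Ranked-within ψ pre post ls λ M → h M ∘ sub all◃
    Ranked-within (and ψ χ)  pre post ls h =
      Ranked-within ψ pre (labelsOf V χ ++ post) ls′ (λ M → h M ∘ sub andˡ◃) ,
      Ranked-within χ (pre ++ labelsOf V ψ) post (trans ls′ (sym (++-assoc pre _ _)))
                    (λ M → Sum.map₁ ∈-++⁺ˡ ∘ h M ∘ sub andʳ◃)
      where ls′ = trans ls (cong (pre ++_) (++-assoc (labelsOf V ψ) (labelsOf V χ) post))
    Ranked-within (or ψ χ)   pre post ls h =
      Ranked-within ψ pre (labelsOf V χ ++ post) ls′ (λ M → h M ∘ sub orˡ◃) ,
      Ranked-within χ (pre ++ labelsOf V ψ) post (trans ls′ (sym (++-assoc pre _ _)))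
                    (λ M → Sum.map₁ ∈-++⁺ˡ ∘ h M ∘ sub orʳ◃)
      where ls′ = trans ls (cong (pre ++_) (++-assoc (labelsOf V ψ) (labelsOf V χ) post))
    Ranked-within (lab P ψ)  pre post ls h =
      (λ M f → labelRank-< pre ls (h M f)) ,
      Ranked-within ψ (pre ++ P ∷ []) post (trans ls (sym (++-assoc pre _ _))) h′
      where
      h′ : ∀ M → FreeIn M ψ → M ∈ pre ++ P ∷ [] ⊎ FreeIn M φ
      h′ M f with M ≟ P
      ... | yes refl = inj₁ (∈-++⁺ʳ pre (here refl))
      ... | no M≢P   = Sum.map₁ ∈-++⁺ˡ (h M (under M≢P f))

    Ranked-regular : Ranked (labelRank φ) φ
    Ranked-regular = Ranked-within φ [] [] (sym (++-identityʳ (labelsOf V φ))) λ _ → inj₂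

  private
    fresh₀ : ∀ m → Fresh m (λ _ → nothing) (suc m)
    fresh₀ m = ≤-refl , λ _ ()

    renStack₀ : ∀ m → RenStack m [] [] (λ _ → nothing)
    renStack₀ m = [] λ _ → refl

  Ranked-Ψ⁰ : ∀ φ → ∃ λ ι → Ranked ι (Ψ V 0 φ)
  Ranked-Ψ⁰ φ with isRegular V φ in reg
  ... | true  = labelRank φ , Ranked-regular φ reg
  ... | false = (λ K → K) , Ranked-ren m (λ _ → nothing) (suc m) φ (fresh₀ m) (Claims≤-maxIdx φ)
    where m = maxIdx V φ

  module _ {𝔄 : Structure V} where

    Wins-Ψ⁰⁺ : ∀ {β r s} φ → Wins 𝔄 β [] φ r s → Wins 𝔄 β [] (Ψ V 0 φ) r s
    Wins-Ψ⁰⁺ φ w with isRegular V φ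
    ... | true  = w
    ... | false = Wins-rename⁺ m w (renStack₀ m) (fresh₀ m) (Claims≤-maxIdx φ)
      where m = maxIdx V φ

    Wins-Ψ⁰⁻ : ∀ {β r s} φ → Wins 𝔄 β [] (Ψ V 0 φ) r s → Wins 𝔄 β [] φ r s
    Wins-Ψ⁰⁻ φ w with isRegular V φ
    ... | true  = w
    ... | false = Wins-rename⁻ m φ w (renStack₀ m) (fresh₀ m) (Claims≤-maxIdx φ)
      where m = maxIdx V φ

  -- Proof search and a uniform budget

  -- inj₁ i stands for the initial value of the variable i, inj₂ n for the n-th fresh constant
  Term : Set
  Term = ℕ ⊎ ℕ

  code : Term → ℕ
  code (inj₁ zero)    = 0
  code (inj₂ zero)    = 1
  code (inj₁ (suc i)) = suc (suc (code (inj₁ i)))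
  code (inj₂ (suc i)) = suc (suc (code (inj₂ i)))

  decode : ℕ → Term
  decode zero          = inj₁ 0
  decode (suc zero)    = inj₂ 0
  decode (suc (suc k)) = Sum.map suc suc (decode k)

  decode-code : ∀ t → decode (code t) ≡ t
  decode-code (inj₁ zero)    = refl
  decode-code (inj₂ zero)    = refl
  decode-code (inj₁ (suc i)) = cong (Sum.map suc suc) (decode-code (inj₁ i))
  decode-code (inj₂ (suc i)) = cong (Sum.map suc suc) (decode-code (inj₂ i))

  Below : ℕ → Term → Set
  Below n (inj₁ _) = ⊤
  Below n (inj₂ j) = j < n

  Below-mono : ∀ {m n} t → m ≤ n → Below m t → Below n t
  Below-mono (inj₁ _) _   _   = tt
  Below-mono (inj₂ _) m≤n j<m = <-≤-trans j<m m≤n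

  decode-below : ∀ k → Below (suc k) (decode k)
  decode-below zero          = tt
  decode-below (suc zero)    = s≤s z≤n
  decode-below (suc (suc k)) with decode k | decode-below k
  ... | inj₁ _ | _   = tt
  ... | inj₂ _ | j<k = s≤s (m≤n⇒m≤1+n j<k)

  record Position : Set where
    constructor pos
    field
      stack   : Stack
      formula : Formula V
      terms   : Var → Term
      sign    : Sign V
      counter : ℕ

  data Expansion : Set where
    continue : List Position → ℕ → Expansion
    fork     : List Position → List Position → Expansion

  -- The queue is a disjunction of positions; the counter n is the next unused constant
  -- inj₂ n.  A position of Eloise's choice between infinitely many elements keeps being
  -- re-queued, trying the k-th term at its k-th visit.
  expand : Position → ℕ → Expansion
  expand p@(pos st (rel R xs) a s k) n = continue (p ∷ []) n
  expand p@(pos st (eq x y)   a s k) n = continue (p ∷ []) n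
  expand (pos st bot        a s k) n = continue [] n
  expand (pos st (neg ψ)    a s k) n = continue (pos st ψ a (flip V s) 0 ∷ []) n
  expand (pos st (and ψ χ)  a + k) n = fork (pos st ψ a + 0 ∷ []) (pos st χ a + 0 ∷ [])
  expand (pos st (and ψ χ)  a - k) n = continue (pos st ψ a - 0 ∷ pos st χ a - 0 ∷ []) n
  expand (pos st (or ψ χ)   a + k) n = continue (pos st ψ a + 0 ∷ pos st χ a + 0 ∷ []) n
  expand (pos st (or ψ χ)   a - k) n = fork (pos st ψ a - 0 ∷ []) (pos st χ a - 0 ∷ [])
  expand (pos st (ex x ψ)   a + k) n =
    continue (pos st ψ (a ⟨ decode k / x ⟩) + 0 ∷ pos st (ex x ψ) a + (suc k) ∷ []) (n ⊔ suc k)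
  expand (pos st (ex x ψ)   a - k) n = continue (pos st ψ (a ⟨ inj₂ n / x ⟩) - 0 ∷ []) (suc n)
  expand (pos st (all' x ψ) a + k) n = continue (pos st ψ (a ⟨ inj₂ n / x ⟩) + 0 ∷ []) (suc n)
  expand (pos st (all' x ψ) a - k) n =
    continue (pos st ψ (a ⟨ decode k / x ⟩) - 0 ∷ pos st (all' x ψ) a - (suc k) ∷ []) (n ⊔ suc k)
  expand (pos st (lab L ψ)  a s k) n = continue (pos ((L , ψ) ∷ st) ψ a s 0 ∷ []) n
  expand (pos st (claim K)  a s k) n =
    continue (Maybe.maybe (λ (ψ , rest) → pos rest (lab K ψ) a s 0 ∷ []) [] (lookup K st)) n

  data NegEq (ps : List Position) : Term → Term → Set where
    negEq : ∀ {st x y a k} → pos st (eq x y) a - k ∈ ps → NegEq ps (a x) (a y)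

  data Axiom (ps : List Position) : Set where
    bot⁻ : ∀ {st a k} → pos st bot a - k ∈ ps → Axiom ps
    eq⁺  : ∀ {st x y a k} → pos st (eq x y) a + k ∈ ps → EqClosure (NegEq ps) (a x) (a y) → Axiom ps
    rel± : ∀ {st st′ R xs ys a a′ k k′} → pos st (rel R xs) a + k ∈ ps → pos st′ (rel R ys) a′ - k′ ∈ ps
         → Pointwise (EqClosure (NegEq ps)) (map a xs) (map a′ ys) → Axiom ps

  data Forks : Position → List Position → List Position → Set where
    and⁺ : ∀ {st ψ χ a k} → Forks (pos st (and ψ χ) a + k) (pos st ψ a + 0 ∷ []) (pos st χ a + 0 ∷ [])
    or⁻  : ∀ {st ψ χ a k} → Forks (pos st (or ψ χ) a - k) (pos st ψ a - 0 ∷ []) (pos st χ a - 0 ∷ [])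

  expand-fork : ∀ q n {ps₁ ps₂} → expand q n ≡ fork ps₁ ps₂ → Forks q ps₁ ps₂
  expand-fork (pos st (and ψ χ)  a + k) n refl = and⁺
  expand-fork (pos st (or ψ χ)   a - k) n refl = or⁻
  expand-fork (pos st (rel R xs) a s k) n ()
  expand-fork (pos st (eq x y)   a s k) n ()
  expand-fork (pos st bot        a s k) n ()
  expand-fork (pos st (neg ψ)    a s k) n ()
  expand-fork (pos st (and ψ χ)  a - k) n ()
  expand-fork (pos st (or ψ χ)   a + k) n ()
  expand-fork (pos st (ex x ψ)   a + k) n ()
  expand-fork (pos st (ex x ψ)   a - k) n ()
  expand-fork (pos st (all' x ψ) a + k) n ()
  expand-fork (pos st (all' x ψ) a - k) n ()
  expand-fork (pos st (lab L ψ)  a s k) n ()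
  expand-fork (pos st (claim K)  a s k) n ()

  data Closed : ℕ → List Position → ℕ → Set where
    axiom    : ∀ {d ps n} → Axiom ps → Closed d ps n
    continue : ∀ {d q qs n news n′} → expand q n ≡ continue news n′ → Closed d (qs ++ news) n′
             → Closed (suc d) (q ∷ qs) n
    fork     : ∀ {d q qs n ps₁ ps₂} → Forks q ps₁ ps₂ → Closed d (qs ++ ps₁) n → Closed d (qs ++ ps₂) n
             → Closed (suc d) (q ∷ qs) n

  Closed-mono : ∀ {d d′ ps n} → d ≤ d′ → Closed d ps n → Closed d′ ps n
  Closed-mono _          (axiom ax)     = axiom ax
  Closed-mono (s≤s d≤d′) (continue e c) = continue e (Closed-mono d≤d′ c)
  Closed-mono (s≤s d≤d′) (fork f c₁ c₂) = fork f (Closed-mono d≤d′ c₁) (Closed-mono d≤d′ c₂)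

  FreshPos : ℕ → Position → Set
  FreshPos n p = ∀ y → Below n (Position.terms p y)

  FreshPos-mono : ∀ {m n} p → m ≤ n → FreshPos m p → FreshPos n p
  FreshPos-mono p m≤n fresh y = Below-mono (Position.terms p y) m≤n (fresh y)

  Below-⟨/⟩ : ∀ {n t} (a : Var → Term) x → (∀ y → Below n (a y)) → Below n t → ∀ y → Below n ((a ⟨ t / x ⟩) y)
  Below-⟨/⟩ a x below-a below-t y with y ≡ᵇ x
  ... | true  = below-t
  ... | false = below-a y

  instantiate-fresh : ∀ {n st ψ χ s} (a : Var → Term) x k → FreshPos n (pos st χ a s k)
                    → n ≤ n ⊔ suc k × All (FreshPos (n ⊔ suc k)) (pos st ψ (a ⟨ decode k / x ⟩) s 0 ∷ pos st χ a s (suc k) ∷ [])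
  instantiate-fresh {n} a x k fr =
    m≤m⊔n n (suc k) , Below-⟨/⟩ a x fr′ (Below-mono (decode k) (m≤n⊔m n (suc k)) (decode-below k)) ∷ fr′ ∷ []
    where fr′ = λ y → Below-mono (a y) (m≤m⊔n n (suc k)) (fr y)

  eigen-fresh : ∀ {n st ψ s} (a : Var → Term) x → (∀ y → Below n (a y))
              → n ≤ suc n × All (FreshPos (suc n)) (pos st ψ (a ⟨ inj₂ n / x ⟩) s 0 ∷ [])
  eigen-fresh {n} a x fr = n≤1+n n , Below-⟨/⟩ a x (λ y → Below-mono (a y) (n≤1+n n) (fr y)) ≤-refl ∷ []

  continue-fresh : ∀ p n {news n′} → expand p n ≡ continue news n′ → FreshPos n p
                 → n ≤ n′ × All (FreshPos n′) news
  continue-fresh (pos st (rel R xs) a s k) n refl fr = ≤-refl , fr ∷ []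
  continue-fresh (pos st (eq x y)   a s k) n refl fr = ≤-refl , fr ∷ []
  continue-fresh (pos st bot        a s k) n refl fr = ≤-refl , []
  continue-fresh (pos st (neg ψ)    a s k) n refl fr = ≤-refl , fr ∷ []
  continue-fresh (pos st (and ψ χ)  a - k) n refl fr = ≤-refl , fr ∷ fr ∷ []
  continue-fresh (pos st (or ψ χ)   a + k) n refl fr = ≤-refl , fr ∷ fr ∷ []
  continue-fresh (pos st (ex x ψ)   a + k) n refl fr = instantiate-fresh a x k fr
  continue-fresh (pos st (ex x ψ)   a - k) n refl fr = eigen-fresh a x fr
  continue-fresh (pos st (all' x ψ) a + k) n refl fr = eigen-fresh a x fr
  continue-fresh (pos st (all' x ψ) a - k) n refl fr = instantiate-fresh a x k fr
  continue-fresh (pos st (lab L ψ)  a s k) n refl fr = ≤-refl , fr ∷ []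
  continue-fresh (pos st (claim K)  a s k) n e    fr with lookup K st | e
  ... | just _  | refl = ≤-refl , fr ∷ []
  ... | nothing | refl = ≤-refl , []

  fork-fresh : ∀ {q n ps₁ ps₂} → Forks q ps₁ ps₂ → FreshPos n q → All (FreshPos n) ps₁ × All (FreshPos n) ps₂
  fork-fresh and⁺ fq = fq ∷ [] , fq ∷ []
  fork-fresh or⁻  fq = fq ∷ [] , fq ∷ []

  module _ {𝔄 : Structure V} where

    WinsAt : (Term → Carrier 𝔄) → ℕ → Position → Set
    WinsAt τ d (pos st χ a s _) = Wins 𝔄 (fin d) st χ (τ ∘ a) s

    Wins-suc : ∀ {d st χ r s} → Wins 𝔄 (fin d) st χ r s → Wins 𝔄 (fin (suc d)) st χ r s
    Wins-suc = Wins-mono (fin≼ (n≤1+n _))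

    WinsAt-suc : ∀ τ d p → WinsAt τ d p → WinsAt τ (suc d) p
    WinsAt-suc τ d (pos _ _ _ _ _) = Wins-suc

    Any-WinsAt-suc : ∀ τ d {ps} → Any (WinsAt τ d) ps → Any (WinsAt τ (suc d)) ps
    Any-WinsAt-suc τ d = Any.map λ {p} → WinsAt-suc τ d p

    shift : ∀ τ d {q} qs {news} → (Any (WinsAt τ d) news → WinsAt τ (suc d) q)
          → Any (WinsAt τ d) (qs ++ news) → Any (WinsAt τ (suc d)) (q ∷ qs)
    shift τ d qs head w with ++⁻ qs w
    ... | inj₁ w′ = there (Any-WinsAt-suc τ d w′)
    ... | inj₂ w′ = here (head w′)

    instantiated : ∀ τ a x k {d st ψ s} → WinsAt τ d (pos st ψ (a ⟨ decode k / x ⟩) s 0)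
                 → ∃ λ c → Wins 𝔄 (fin (suc d)) st ψ ((τ ∘ a) ⟨ c / x ⟩) s
    instantiated τ a x k w = τ (decode k) , Wins-resp-≗ (∘-⟨/⟩ τ a (decode k) x) (Wins-suc w)

    reassign : (Term → Carrier 𝔄) → ℕ → Carrier 𝔄 → Term → Carrier 𝔄
    reassign τ n c (inj₁ i) = τ (inj₁ i)
    reassign τ n c (inj₂ j) = if j ≡ᵇ n then c else τ (inj₂ j)

    reassign-below : ∀ τ {n} c t → Below n t → reassign τ n c t ≡ τ t
    reassign-below τ c (inj₁ i) _   = refl
    reassign-below τ {n} c (inj₂ j) j<n with j ≡ᵇ n | ≡ᵇ-reflects j n
    ... | true  | ofʸ refl = ⊥-elim (<-irrefl refl j<n)
    ... | false | _        = refl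

    reassign-⟨/⟩ : ∀ τ {n} c (a : Var → Term) x → (∀ y → Below n (a y))
                 → reassign τ n c ∘ (a ⟨ inj₂ n / x ⟩) ≗ (τ ∘ a) ⟨ c / x ⟩
    reassign-⟨/⟩ τ {n} c a x below y with y ≡ᵇ x
    ... | false = reassign-below τ c (a y) (below y)
    ... | true with n ≡ᵇ n | ≡ᵇ-reflects n n
    ...   | true  | _       = refl
    ...   | false | ofⁿ n≢n = ⊥-elim (n≢n refl)

    -- inj₂ n is fresh, so its value can be chosen freely
    eigen-sound : ExcludedMiddle 0ℓ → ∀ x {d n st ψ a s} qs → All (FreshPos n) qs → (∀ y → Below n (a y))
                → (∀ τ → Any (WinsAt τ d) (qs ++ pos st ψ (a ⟨ inj₂ n / x ⟩) s 0 ∷ []))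
                → ∀ τ → Any (WinsAt τ (suc d)) qs ⊎ (∀ c → Wins 𝔄 (fin (suc d)) st ψ ((τ ∘ a) ⟨ c / x ⟩) s)
    eigen-sound em x {d} {n} {st} {ψ} {a} {s} qs fresh-qs fresh-a ih τ with em {Any (WinsAt τ (suc d)) qs}
    ... | yes w = inj₁ w
    ... | no ¬w = inj₂ λ c → eigen c (++⁻ qs (ih (reassign τ n c)))
      where
      unassign : ∀ {c ps} → All (FreshPos n) ps → Any (WinsAt (reassign τ n c) d) ps → Any (WinsAt τ d) ps
      unassign (fr ∷ _)  (here w)  = here (Wins-resp-≗ (λ y → reassign-below τ _ _ (fr y)) w)
      unassign (_ ∷ frs) (there w) = there (unassign frs w)

      eigen : ∀ c → Any (WinsAt (reassign τ n c) d) qs ⊎ Any (WinsAt (reassign τ n c) d) (pos st ψ (a ⟨ inj₂ n / x ⟩) s 0 ∷ [])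
            → Wins 𝔄 (fin (suc d)) st ψ ((τ ∘ a) ⟨ c / x ⟩) s
      eigen c (inj₁ w)        = ⊥-elim (¬w (Any-WinsAt-suc τ d (unassign fresh-qs w)))
      eigen c (inj₂ (here w)) = Wins-suc (Wins-resp-≗ (reassign-⟨/⟩ τ c a x fresh-a) w)

    axiom-sound : ExcludedMiddle 0ℓ → ∀ {ps} → Axiom ps → ∀ τ d → Any (WinsAt τ d) ps
    axiom-sound em {ps} ax τ d with em {Any (WinsAt τ d) ps}
    ... | yes w = w
    ... | no ¬w = from-axiom ax
      where
      -- otherwise every negative equation of ps holds under τ, or Eloise would win there
      respects : ∀ {t u} → NegEq ps t u → τ t ≡ τ u
      respects (negEq t∈) = em⇒dne em λ t≢u → ¬w (lose t∈ (eqN t≢u))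

      closure : ∀ {t u} → EqClosure (NegEq ps) t u → τ t ≡ τ u
      closure = gfold isEquivalence τ respects

      from-axiom : Axiom ps → Any (WinsAt τ d) ps
      from-axiom (bot⁻ p∈)    = lose p∈ botN
      from-axiom (eq⁺ p∈ t≈u) = lose p∈ (eqP (closure t≈u))
      from-axiom (rel± {R = R} {xs} {ys} {a} {a′} p∈ p′∈ ts≈us) with em {relI 𝔄 R (map (τ ∘ a) xs)}
      ... | yes holds = lose p∈ (relP holds)
      ... | no fails  = lose p′∈ (relN (fails ∘ subst (relI 𝔄 R) (sym same)))
        where
        same : map (τ ∘ a) xs ≡ map (τ ∘ a′) ys
        same = trans (map-∘ τ a xs) (trans (Pointwise-≡⇒≡ (map⁺ closure ts≈us)) (sym (map-∘ τ a′ ys)))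

    continue-sound : ExcludedMiddle 0ℓ → ∀ q qs {n news n′} d → expand q n ≡ continue news n′
                   → FreshPos n q → All (FreshPos n) qs → (∀ τ → Any (WinsAt τ d) (qs ++ news))
                   → ∀ τ → Any (WinsAt τ (suc d)) (q ∷ qs)
    continue-sound em q@(pos st (rel R xs) a s k) qs d refl _ _ ih τ =
      shift τ d qs (WinsAt-suc τ d q ∘ singleton⁻) (ih τ)
    continue-sound em q@(pos st (eq x y) a s k) qs d refl _ _ ih τ =
      shift τ d qs (WinsAt-suc τ d q ∘ singleton⁻) (ih τ)
    continue-sound em (pos st bot a s k) qs d refl _ _ ih τ = shift τ d qs (λ ()) (ih τ)
    continue-sound em (pos st (neg ψ) a s k) qs d refl _ _ ih τ =
      shift τ d qs (negW ∘ Wins-suc ∘ singleton⁻) (ih τ)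
    continue-sound em (pos st (and ψ χ) a - k) qs d refl _ _ ih τ =
      shift τ d qs (λ { (here w) → andNL (Wins-suc w) ; (there (here w)) → andNR (Wins-suc w) }) (ih τ)
    continue-sound em (pos st (or ψ χ) a + k) qs d refl _ _ ih τ =
      shift τ d qs (λ { (here w) → orPL (Wins-suc w) ; (there (here w)) → orPR (Wins-suc w) }) (ih τ)
    continue-sound em (pos st (ex x ψ) a + k) qs d refl _ _ ih τ =
      shift τ d qs (λ { (here w) → exP (instantiated τ a x k w) ; (there (here w)) → Wins-suc w }) (ih τ)
    continue-sound em (pos st (all' x ψ) a - k) qs d refl _ _ ih τ =
      shift τ d qs (λ { (here w) → allN (instantiated τ a x k w) ; (there (here w)) → Wins-suc w }) (ih τ)
    continue-sound em (pos st (ex x ψ) a - k) qs d refl fq fqs ih τ with eigen-sound em x qs fqs fq ih τ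
    ... | inj₁ w = there w
    ... | inj₂ h = here (exN h)
    continue-sound em (pos st (all' x ψ) a + k) qs d refl fq fqs ih τ with eigen-sound em x qs fqs fq ih τ
    ... | inj₁ w = there w
    ... | inj₂ h = here (allP h)
    continue-sound em (pos st (lab L ψ) a s k) qs d refl _ _ ih τ =
      shift τ d qs (labW ∘ Wins-suc ∘ singleton⁻) (ih τ)
    continue-sound em (pos st (claim K) a s k) qs d e _ _ ih τ with lookup K st in lk | e
    ... | just _  | refl = shift τ d qs (claimW suc↝ lk ∘ singleton⁻) (ih τ)
    ... | nothing | refl = shift τ d qs (λ ()) (ih τ)

    fork-sound : ∀ τ d {q qs ps₁ ps₂} → Forks q ps₁ ps₂ → Any (WinsAt τ d) (qs ++ ps₁) → Any (WinsAt τ d) (qs ++ ps₂)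
               → Any (WinsAt τ (suc d)) (q ∷ qs)
    fork-sound τ d {qs = qs} f w₁ w₂ with ++⁻ qs w₁ | ++⁻ qs w₂
    ... | inj₁ w | _      = there (Any-WinsAt-suc τ d w)
    ... | inj₂ _ | inj₁ w = there (Any-WinsAt-suc τ d w)
    fork-sound τ d and⁺ _ _ | inj₂ (here w₁) | inj₂ (here w₂) = here (andP (Wins-suc w₁) (Wins-suc w₂))
    fork-sound τ d or⁻  _ _ | inj₂ (here w₁) | inj₂ (here w₂) = here (orN (Wins-suc w₁) (Wins-suc w₂))

    Closed-sound : ExcludedMiddle 0ℓ → ∀ {d ps n} → Closed d ps n → All (FreshPos n) ps
                 → ∀ τ → Any (WinsAt τ d) ps
    Closed-sound em (axiom ax) _ τ = axiom-sound em ax τ _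
    Closed-sound em (continue {q = q} {qs} {n} e c) (fq ∷ fqs) τ with continue-fresh q n e fq
    ... | n≤n′ , fnews =
      continue-sound em q qs _ e fq fqs (Closed-sound em c (All-++⁺ (All.map (λ {p} → FreshPos-mono p n≤n′) fqs) fnews)) τ
    Closed-sound em (fork f c₁ c₂) (fq ∷ fqs) τ =
      fork-sound τ _ f (Closed-sound em c₁ (All-++⁺ fqs (proj₁ (fork-fresh f fq))) τ)
                   (Closed-sound em c₂ (All-++⁺ fqs (proj₂ (fork-fresh f fq))) τ)

  Node : Set
  Node = List Position × ℕ

  Open : Node → Set
  Open N = ∀ d → ¬ Closed d (proj₁ N) (proj₂ N)

  successors : Expansion → Bool → List Position
  successors (continue news _) _ = news
  successors (fork ps₁ ps₂)    b = if b then ps₁ else ps₂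

  counterAfter : Expansion → ℕ → ℕ
  counterAfter (continue _ n′) _ = n′
  counterAfter (fork _ _)      n = n

  fork-choice : ∀ {ps₁ ps₂ Q} b → successors (fork ps₁ ps₂) b ⊆ Q → ps₁ ⊆ Q ⊎ ps₂ ⊆ Q
  fork-choice true  ⊆Q = inj₁ ⊆Q
  fork-choice false ⊆Q = inj₂ ⊆Q

  advance : Node → Bool → Node
  advance ([]     , n) _ = [] , n
  advance (q ∷ qs , n) b = qs ++ successors (expand q n) b , counterAfter (expand q n) n

  advance-head : ∀ N b {p rest} → proj₁ N ≡ p ∷ rest → proj₁ (advance N b) ≡ rest ++ successors (expand p (proj₂ N)) b
  advance-head (q ∷ qs , n) b refl = refl

  advance-keeps : ∀ N b {p} → (∀ n → expand p n ≡ continue (p ∷ []) n) → p ∈ proj₁ N → p ∈ proj₁ (advance N b)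
  advance-keeps (q ∷ qs , n) b requeued (here refl) rewrite requeued n = ∈-++⁺ʳ qs (here refl)
  advance-keeps (q ∷ qs , n) b requeued (there p∈)  = ∈-++⁺ˡ p∈

  open-advance : ExcludedMiddle 0ℓ → ∀ N → Open N → ∃ λ b → Open (advance N b)
  open-advance em ([]     , n) open₀ = true , open₀
  open-advance em (q ∷ qs , n) open₀ with expand q n in e
  ... | continue news n′ = true , λ d c → open₀ (suc d) (continue e c)
  ... | fork ps₁ ps₂ with em {Open (qs ++ ps₁ , n)}
  ...   | yes open₁ = true , open₁
  ...   | no ¬open₁ = false , λ d₂ c₂ → ¬open₁ λ d₁ c₁ →
          open₀ (suc (d₁ ⊔ d₂)) (fork (expand-fork q n e) (Closed-mono (m≤m⊔n d₁ d₂) c₁) (Closed-mono (m≤n⊔m d₁ d₂) c₂))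

  -- An open root yields an infinite branch of open nodes; it is fair to every position,
  -- so the negative atoms met along it describe a structure in which Eloise wins nowhere.
  module Branch (em : ExcludedMiddle 0ℓ) (root : Node) (open-root : Open root) where

    branch : ℕ → Σ Node Open
    branch zero    = root , open-root
    branch (suc i) = advance (proj₁ (branch i)) (proj₁ step) , proj₂ step
      where step = open-advance em (proj₁ (branch i)) (proj₂ (branch i))

    queue : ℕ → List Position
    queue i = proj₁ (proj₁ (branch i))

    counter : ℕ → ℕ
    counter i = proj₂ (proj₁ (branch i))

    choice : ℕ → Bool
    choice i = proj₁ (open-advance em (proj₁ (branch i)) (proj₂ (branch i)))

    no-axiom : ∀ i → ¬ Axiom (queue i)
    no-axiom i ax = proj₂ (branch i) 0 (axiom ax)

    reaches-head : ∀ i {p qs ys} → queue i ≡ qs ++ ys → p ∈ qs → ∃ λ j → ∃ λ rest → queue j ≡ p ∷ rest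
    reaches-head i e (here refl) = i , _ , e
    reaches-head i {qs = _ ∷ qs} {ys} e (there p∈) =
      reaches-head (suc i) (trans (advance-head (proj₁ (branch i)) (choice i) e) (++-assoc qs ys _)) p∈

    eventually-expanded : ∀ i {p} → p ∈ queue i → ∃ λ j → successors (expand p (counter j)) (choice j) ⊆ queue (suc j)
    eventually-expanded i p∈ with reaches-head i (sym (++-identityʳ _)) p∈
    ... | j , rest , e = j , λ r∈ → subst (_ ∈_) (sym (advance-head (proj₁ (branch j)) (choice j) e)) (∈-++⁺ʳ rest r∈)

    persists : ∀ {p} → (∀ n → expand p n ≡ continue (p ∷ []) n) → ∀ {i j} → i ≤ j → p ∈ queue i → p ∈ queue j
    persists requeued {j = zero}  z≤n p∈ = p∈
    persists requeued {j = suc j} i≤ p∈ with m≤n⇒m<n∨m≡n i≤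
    ... | inj₁ (s≤s i≤j) = advance-keeps (proj₁ (branch j)) (choice j) requeued (persists requeued i≤j p∈)
    ... | inj₂ refl      = p∈

    choice-successors : ∀ {st χ ψ a s x}
                      → (∀ k n → expand (pos st χ a s k) n
                                 ≡ continue (pos st ψ (a ⟨ decode k / x ⟩) s 0 ∷ pos st χ a s (suc k) ∷ []) (n ⊔ suc k))
                      → ∀ k i → pos st χ a s k ∈ queue i
                      → ∃ λ j → pos st ψ (a ⟨ decode k / x ⟩) s 0 ∈ queue j × pos st χ a s (suc k) ∈ queue j
    choice-successors {st} {χ} {ψ} {a} {s} {x} requeues k i p∈ =
      let j , succ⊆ = eventually-expanded i p∈
          succ⊆′ = subst (λ e → successors e (choice j) ⊆ queue (suc j)) (requeues k (counter j)) succ⊆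
      in suc j , succ⊆′ (here refl) , succ⊆′ (there (here refl))

    instances : ∀ {st χ ψ a s x}
              → (∀ k n → expand (pos st χ a s k) n
                         ≡ continue (pos st ψ (a ⟨ decode k / x ⟩) s 0 ∷ pos st χ a s (suc k) ∷ []) (n ⊔ suc k))
              → ∀ m k i → pos st χ a s k ∈ queue i → ∀ t → code t ≡ m ℕ.+ k
              → ∃ λ j → pos st ψ (a ⟨ t / x ⟩) s 0 ∈ queue j
    instances {st} {χ} {ψ} {a} {s} {x} requeues zero k i p∈ t code-t =
      let j , inst∈ , _ = choice-successors requeues k i p∈
      in j , subst (λ u → pos st ψ (a ⟨ u / x ⟩) s 0 ∈ queue j) (trans (cong decode (sym code-t)) (decode-code t)) inst∈
    instances requeues (suc m) k i p∈ t code-t =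
      let j , _ , next∈ = choice-successors requeues k i p∈
      in instances requeues m (suc k) j next∈ t (trans code-t (sym (+-suc m k)))

    Stage : ℕ → Term → Term → Set
    Stage i = EqClosure (NegEq (queue i))

    Stage-mono : ∀ {i j t u} → i ≤ j → Stage i t u → Stage j t u
    Stage-mono i≤j = EqClosure.map λ where (negEq p∈) → negEq (persists (λ _ → refl) i≤j p∈)

    _≈_ : Term → Term → Set
    t ≈ u = ∃ λ i → Stage i t u

    ≈-refl : ∀ {t} → t ≈ t
    ≈-refl = 0 , EqClosure.reflexive _

    ≈-sym : ∀ {t u} → t ≈ u → u ≈ t
    ≈-sym (i , t≈u) = i , EqClosure.symmetric _ t≈u

    ≈-trans : ∀ {t u v} → t ≈ u → u ≈ v → t ≈ v
    ≈-trans (i , t≈u) (j , u≈v) =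
      i ⊔ j , EqClosure.transitive _ (Stage-mono (m≤m⊔n i j) t≈u) (Stage-mono (m≤n⊔m i j) u≈v)

    -- excluded middle finds a member of least code in each class; f only bounds the descent
    least : ∀ f t → code t < f → ∃ λ c → c ≈ t × (∀ u → u ≈ c → code c ≤ code u)
    least (suc f) t t<f with em {∃ λ u → u ≈ t × code u < code t}
    ... | yes (u , u≈t , u<t) with least f u (<-≤-trans u<t (s≤s⁻¹ t<f))
    ...   | c , c≈u , minimal = c , ≈-trans c≈u u≈t , minimal
    least (suc f) t t<f | no ¬smaller =
      t , ≈-refl , λ u u≈t → ≮⇒≥ λ u<t → ¬smaller (u , u≈t , u<t)

    canon : Term → Term
    canon t = proj₁ (least (suc (code t)) t ≤-refl)

    canon-≈ : ∀ t → canon t ≈ t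
    canon-≈ t = proj₁ (proj₂ (least (suc (code t)) t ≤-refl))

    canon-resp : ∀ {t u} → t ≈ u → canon t ≡ canon u
    canon-resp {t} {u} t≈u = code-injective (≤-antisym (minimal t _ c≈c′) (minimal u _ (≈-sym c≈c′)))
      where
      minimal : ∀ w v → v ≈ canon w → code (canon w) ≤ code v
      minimal w = proj₂ (proj₂ (least (suc (code w)) w ≤-refl))

      c≈c′ : canon u ≈ canon t
      c≈c′ = ≈-trans (canon-≈ u) (≈-trans (≈-sym t≈u) (≈-sym (canon-≈ t)))

      code-injective : code (canon t) ≡ code (canon u) → canon t ≡ canon u
      code-injective e = trans (sym (decode-code _)) (trans (cong decode e) (decode-code _))

    -- the quotient of the terms by ≈, as the set of canonical representatives
    Element : Set
    Element = Σ Term λ t → canon t ≡ t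

    element-≡ : ∀ {c c′ : Element} → proj₁ c ≡ proj₁ c′ → c ≡ c′
    element-≡ refl = Σ-≡,≡→≡ (refl , Decidable⇒UIP.≡-irrelevant (≡-dec _≟_ _≟_) _ _)

    el : Term → Element
    el t = canon t , canon-resp (canon-≈ t)

    el-resp : ∀ {t u} → t ≈ u → el t ≡ el u
    el-resp t≈u = element-≡ (canon-resp t≈u)

    el-≈ : ∀ {t u} → el t ≡ el u → t ≈ u
    el-≈ {t} {u} e = ≈-trans (≈-sym (canon-≈ t)) (subst (_≈ u) (sym (cong proj₁ e)) (canon-≈ u))

    el-proj₁ : ∀ c → el (proj₁ c) ≡ c
    el-proj₁ (t , canon-t) = element-≡ canon-t

    data NegAtom (R : Symbol V) (v : Vec Element (arity V R)) : Set where
      negAtom : ∀ i {st ys a k} → pos st (rel R ys) a - k ∈ queue i → map (el ∘ a) ys ≡ v → NegAtom R v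

    𝔐 : Structure V
    𝔐 = record { Carrier = Element ; relI = NegAtom }

    ≈-∷ : ∀ {n u v} {us vs : Vec Term n} → u ≈ v → (∃ λ i → Pointwise (Stage i) us vs)
        → ∃ λ i → Pointwise (Stage i) (u ∷ us) (v ∷ vs)
    ≈-∷ (i , u≈v) (j , us≈vs) = i ⊔ j , Stage-mono (m≤m⊔n i j) u≈v ∷ Pointwise.map (Stage-mono (m≤n⊔m i j)) us≈vs

    ≈-vec : ∀ {n} (us vs : Vec Term n) → map el us ≡ map el vs → ∃ λ i → Pointwise (Stage i) us vs
    ≈-vec []       []       _ = 0 , []
    ≈-vec (u ∷ us) (v ∷ vs) e = ≈-∷ (el-≈ (∷-injectiveˡ e)) (≈-vec us vs (∷-injectiveʳ e))

    el-⟨/⟩ : ∀ {a : Var → Term} {r : Var → Element} t x → el ∘ a ≗ r → el ∘ (a ⟨ t / x ⟩) ≗ r ⟨ el t / x ⟩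
    el-⟨/⟩ {a} t x a≗r y = trans (∘-⟨/⟩ el a t x y) (⟨/⟩-cong (el t) x a≗r y)

    el-⟨/⟩-proj₁ : ∀ {a : Var → Term} {r : Var → Element} c x → el ∘ a ≗ r → el ∘ (a ⟨ proj₁ c / x ⟩) ≗ r ⟨ c / x ⟩
    el-⟨/⟩-proj₁ {r = r} c x a≗r y = trans (el-⟨/⟩ (proj₁ c) x a≗r y) (cong (λ e → (r ⟨ e / x ⟩) y) (el-proj₁ c))

    claim-successor : ∀ st {K ψ rest a s} → lookup K st ≡ just (ψ , rest)
                    → ∀ n b → pos rest (lab K ψ) a s 0 ∈ successors (expand (pos st (claim K) a s 0) n) b
    claim-successor st lk n b rewrite lk = here refl

    atoms-clash : ∀ i i′ {st st′ R xs ys a a′ k k′} → pos st (rel R xs) a + k ∈ queue i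
                → pos st′ (rel R ys) a′ - k′ ∈ queue i′ → map el (map a xs) ≡ map el (map a′ ys) → ⊥
    atoms-clash i i′ {xs = xs} {ys} {a} {a′} p∈ p′∈ same = clash (≈-vec (map a xs) (map a′ ys) same)
      where
      clash : (∃ λ i″ → Pointwise (Stage i″) (map a xs) (map a′ ys)) → ⊥
      clash (i″ , ts≈us) =
        no-axiom (i ⊔ (i′ ⊔ i″)) (rel± (persists (λ _ → refl) (m≤m⊔n i _) p∈)
                                       (persists (λ _ → refl) (≤-trans (m≤m⊔n i′ i″) (m≤n⊔m i _)) p′∈)
                                       (Pointwise.map (Stage-mono (≤-trans (m≤n⊔m i′ i″) (m≤n⊔m i _))) ts≈us))

    equation-clash : ∀ i {st x y a k} → pos st (eq x y) a + k ∈ queue i → a x ≈ a y → ⊥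
    equation-clash i p∈ (i′ , ax≈ay) =
      no-axiom (i ⊔ i′) (eq⁺ (persists (λ _ → refl) (m≤m⊔n i i′) p∈) (Stage-mono (m≤n⊔m i i′) ax≈ay))

    refuted : ∀ {β st χ r s} → Wins 𝔐 β st χ r s → ∀ i a → pos st χ a s 0 ∈ queue i → el ∘ a ≗ r → ⊥
    refuted (relP {xs = xs} (negAtom i′ {ys = ys} {a′} p′∈ e′)) i a p∈ a≗r =
      atoms-clash i i′ p∈ p′∈ (trans (sym (map-∘ el a xs)) (trans (map-cong a≗r xs) (trans (sym e′) (map-∘ el a′ ys))))
    refuted (relN {xs = xs} ¬holds) i a p∈ a≗r = ¬holds (negAtom i p∈ (map-cong a≗r xs))
    refuted (eqP {x = x} {y} ax≡ay) i a p∈ a≗r =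
      equation-clash i p∈ (el-≈ (trans (a≗r x) (trans ax≡ay (sym (a≗r y)))))
    refuted (eqN {x = x} {y} ax≢ay) i a p∈ a≗r =
      ax≢ay (trans (sym (a≗r x)) (trans (el-resp (i , EqClosure.return (negEq p∈))) (a≗r y)))
    refuted botN i a p∈ a≗r = no-axiom i (bot⁻ p∈)
    refuted (negW w) i a p∈ a≗r =
      let j , succ⊆ = eventually-expanded i p∈ in refuted w (suc j) a (succ⊆ (here refl)) a≗r
    refuted (andP w w′) i a p∈ a≗r =
      let j , succ⊆ = eventually-expanded i p∈ in
      Sum.[ (λ ⊆₁ → refuted w (suc j) a (⊆₁ (here refl)) a≗r) , (λ ⊆₂ → refuted w′ (suc j) a (⊆₂ (here refl)) a≗r) ]
        (fork-choice (choice j) succ⊆)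
    refuted (andNL w) i a p∈ a≗r =
      let j , succ⊆ = eventually-expanded i p∈ in refuted w (suc j) a (succ⊆ (here refl)) a≗r
    refuted (andNR w) i a p∈ a≗r =
      let j , succ⊆ = eventually-expanded i p∈ in refuted w (suc j) a (succ⊆ (there (here refl))) a≗r
    refuted (orPL w) i a p∈ a≗r =
      let j , succ⊆ = eventually-expanded i p∈ in refuted w (suc j) a (succ⊆ (here refl)) a≗r
    refuted (orPR w) i a p∈ a≗r =
      let j , succ⊆ = eventually-expanded i p∈ in refuted w (suc j) a (succ⊆ (there (here refl))) a≗r
    refuted (orN w w′) i a p∈ a≗r =
      let j , succ⊆ = eventually-expanded i p∈ in
      Sum.[ (λ ⊆₁ → refuted w (suc j) a (⊆₁ (here refl)) a≗r) , (λ ⊆₂ → refuted w′ (suc j) a (⊆₂ (here refl)) a≗r) ]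
        (fork-choice (choice j) succ⊆)
    refuted (allP {x = x} h) i a p∈ a≗r =
      let j , succ⊆ = eventually-expanded i p∈
      in refuted (h (el (inj₂ (counter j)))) (suc j) _ (succ⊆ (here refl)) (el-⟨/⟩ _ x a≗r)
    refuted (exN {x = x} h) i a p∈ a≗r =
      let j , succ⊆ = eventually-expanded i p∈
      in refuted (h (el (inj₂ (counter j)))) (suc j) _ (succ⊆ (here refl)) (el-⟨/⟩ _ x a≗r)
    refuted (allN {x = x} (c , w)) i a p∈ a≗r =
      let j , inst∈ = instances (λ _ _ → refl) (code (proj₁ c)) 0 i p∈ (proj₁ c) (sym (+-identityʳ _))
      in refuted w j _ inst∈ (el-⟨/⟩-proj₁ c x a≗r)
    refuted (exP {x = x} (c , w)) i a p∈ a≗r =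
      let j , inst∈ = instances (λ _ _ → refl) (code (proj₁ c)) 0 i p∈ (proj₁ c) (sym (+-identityʳ _))
      in refuted w j _ inst∈ (el-⟨/⟩-proj₁ c x a≗r)
    refuted (labW w) i a p∈ a≗r =
      let j , succ⊆ = eventually-expanded i p∈ in refuted w (suc j) a (succ⊆ (here refl)) a≗r
    refuted {st = st} (claimW _ lk w) i a p∈ a≗r =
      let j , succ⊆ = eventually-expanded i p∈
      in refuted w (suc j) a (succ⊆ (claim-successor st lk (counter j) (choice j))) a≗r

  uniform-budget : ExcludedMiddle 0ℓ → ∀ χ → (∀ 𝔄 s → Wins 𝔄 ∞ [] χ s +) → ∃ λ d → ∀ 𝔄 s → Wins 𝔄 (fin d) [] χ s +
  uniform-budget em χ wins with em {∃ λ d → Closed d (pos [] χ inj₁ + 0 ∷ []) 0}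
  ... | yes (d , closed) = d , λ 𝔄 s → singleton⁻ (Closed-sound em closed ((λ _ → tt) ∷ []) Sum.[ s , (λ _ → s 0) ])
  ... | no ¬closed = ⊥-elim (refuted (wins 𝔐 (el ∘ inj₁)) 0 inj₁ (here refl) λ _ → refl)
    where
    open-root : Open (pos [] χ inj₁ + 0 ∷ [] , 0)
    open-root d c = ¬closed (d , c)

    open Branch em (pos [] χ inj₁ + 0 ∷ [] , 0) open-root

theorem4p5 : ExcludedMiddle 0ℓ → (V : Vocabulary) (φ : Formula V)
    → Valid V φ ⇔ ∃ (λ (n : ℕ) → FOValid V (Φ V n φ))
theorem4p5 em V φ = mk⇔ valid⇒approximant approximant⇒valid
  where
  ι : Label → ℕ
  ι = proj₁ (Ranked-Ψ⁰ V φ)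

  ranked : Ranked V ι (Ψ V 0 φ)
  ranked = proj₂ (Ranked-Ψ⁰ V φ)

  valid⇒approximant : Valid V φ → ∃ λ n → FOValid V (Φ V n φ)
  valid⇒approximant valid with uniform-budget V em (Ψ V 0 φ) (λ 𝔄 s → Wins-Ψ⁰⁺ V φ (EWins⇒Wins V (valid 𝔄 s)))
  ... | d , wins = d , λ 𝔄 s → Wins₀⇒FOWins V (Wins-Ψ⁺ V ι φ ranked d (wins 𝔄 s))

  approximant⇒valid : ∃ (λ n → FOValid V (Φ V n φ)) → Valid V φ
  approximant⇒valid (n , fo-valid) 𝔄 s =
    Wins⇒EWins V (Wins-Ψ⁰⁻ V φ (Wins-Ψ⁻ V ι φ ranked n (FOWins⇒Wins V em {β = ∞} (Ψ V n φ) + s (fo-valid 𝔄 s)))) root refl
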